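{- Let $H$ be a connected regular graph and let $G$ be a class 1 nearly regular graph, i.e. there is a connected nontrivial $r$-regular graph $G'$ with $\chi'(G')=r$ and a perfect matching $M$ of $G'$ such that the spanning subgraph $G'-M$ is class 1, and $G=G'-X$ for some nonempty proper subset $X\subsetneq M$. Then $\check s(G\,\Box\, H)=2$.
   Context: All graphs are finite and simple. A proper edge-coloring assigns colors to edges so that incident edges receive different colors. For a proper edge-coloring $f$ of a graph $G$, the palette of a vertex $v$ is $P_f(v)=\{f(e): e \text{ is incident to } v\}$. The palette index $\check s(G)$ is the minimum, over all proper edge-colorings $f$ of $G$, of the number of distinct palettes $P_f(v)$, $v\in V(G)$. A graph is class 1 if its chromatic index equals its maximum degree $\Delta$. $G'-X$ denotes the spanning subgraph with edge set $E(G')\setminus X$. The Cartesian product $G\,\Box\, H$ has vertex set $V(G)\times V(H)$, with $(x_1,x_2)(y_1,y_2)$ an edge iff either $x_1y_1\in E(G)$ and $x_2=y_2$, or $x_2y_2\in E(H)$ and $x_1=y_1$. -}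

module Defs where

open import Data.Nat using (ℕ; _≤_; _<_; _⊔_)
open import Data.Fin using (Fin; _≟_)
open import Data.Bool using (Bool; true; false; _∧_; _∨_; not; if_then_else_)
open import Data.List using (List; map; foldr; allFin)
open import Data.Nat.ListAction using (sum)
open import Data.Product using (Σ; ∃; _×_; _,_)
open import Relation.Binary.PropositionalEquality using (_≡_)
open import Relation.Nullary.Decidable using (⌊_⌋)

Graph : Set → Set
Graph V = V → V → Bool

Adj : {V : Set} → Graph V → V → V → Set
Adj G u v = G u v ≡ true

IsSimple : {V : Set} → Graph V → Set
IsSimple G = (∀ u v → G u v ≡ G v u) × (∀ u → G u u ≡ false)

deg : {n : ℕ} → Graph (Fin n) → Fin n → ℕ
deg {n} G v = sum (map (λ u → if G v u then 1 else 0) (allFin n))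

maxDeg : {n : ℕ} → Graph (Fin n) → ℕ
maxDeg {n} G = foldr _⊔_ 0 (map (deg G) (allFin n))

IsRegularOfDegree : {n : ℕ} → Graph (Fin n) → ℕ → Set
IsRegularOfDegree G r = ∀ v → deg G v ≡ r

IsRegular : {n : ℕ} → Graph (Fin n) → Set
IsRegular G = ∃ λ r → IsRegularOfDegree G r

data Reach {V : Set} (G : Graph V) : V → V → Set where
  here : ∀ {u} → Reach G u u
  step : ∀ {u v w} → Adj G u v → Reach G v w → Reach G u w

Connected : {n : ℕ} → Graph (Fin n) → Set
Connected {n} G = (0 < n) × (∀ u v → Reach G u v)

-- proper edge-colorings with colors in ℕ; f u v is the color of the edge uv
-- (values on non-edges are irrelevant)
IsProperEdgeColoring : {V : Set} → Graph V → (V → V → ℕ) → Set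
IsProperEdgeColoring G f =
  (∀ u v → Adj G u v → f u v ≡ f v u) ×
  (∀ u v w → Adj G u v → Adj G u w → f u v ≡ f u w → v ≡ w)

EdgeColorable : {V : Set} → Graph V → ℕ → Set
EdgeColorable G k = Σ (_ → _ → ℕ) λ f →
  IsProperEdgeColoring G f × (∀ u v → Adj G u v → f u v < k)

ChromaticIndex : {V : Set} → Graph V → ℕ → Set
ChromaticIndex G k = EdgeColorable G k × (∀ k′ → EdgeColorable G k′ → k ≤ k′)

ClassOne : {n : ℕ} → Graph (Fin n) → Set
ClassOne G = ChromaticIndex G (maxDeg G)

InPalette : {V : Set} → Graph V → (V → V → ℕ) → V → ℕ → Set
InPalette G f v c = ∃ λ u → Adj G v u × f v u ≡ c

SamePalette : {V : Set} → Graph V → (V → V → ℕ) → V → V → Set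
SamePalette G f u v =
  ∀ c → (InPalette G f u c → InPalette G f v c) × (InPalette G f v c → InPalette G f u c)

-- f has exactly k distinct palettes: a surjective labelling of vertices by Fin k
-- whose fibres are exactly the classes of vertices with equal palettes
NumPalettes : {V : Set} → Graph V → (V → V → ℕ) → ℕ → Set
NumPalettes {V} G f k = Σ (V → Fin k) λ p →
  (∀ i → ∃ λ v → p v ≡ i) ×
  (∀ u v → (p u ≡ p v → SamePalette G f u v) × (SamePalette G f u v → p u ≡ p v))

PaletteIndex : {V : Set} → Graph V → ℕ → Set
PaletteIndex G k =
  (Σ (_ → _ → ℕ) λ f → IsProperEdgeColoring G f × NumPalettes G f k) ×
  (∀ f m → IsProperEdgeColoring G f → NumPalettes G f m → k ≤ m)

_∖_ : {V : Set} → Graph V → Graph V → Graph V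
(G ∖ X) u v = G u v ∧ not (X u v)

EdgeSubset : {V : Set} → Graph V → Graph V → Set
EdgeSubset X G = (∀ u v → X u v ≡ X v u) × (∀ u v → Adj X u v → Adj G u v)

PerfectMatching : {n : ℕ} → Graph (Fin n) → Graph (Fin n) → Set
PerfectMatching G M = EdgeSubset M G × (∀ v → deg M v ≡ 1)

NonemptyProperSubset : {V : Set} → Graph V → Graph V → Set
NonemptyProperSubset X M =
  EdgeSubset X M × (∃ λ u → ∃ λ v → Adj X u v) ×
  (∃ λ u → ∃ λ v → Adj M u v × X u v ≡ false)

_□_ : {n m : ℕ} → Graph (Fin n) → Graph (Fin m) → Graph (Fin n × Fin m)
(G □ H) (a , b) (c , d) = (G a c ∧ ⌊ b ≟ d ⌋) ∨ (⌊ a ≟ c ⌋ ∧ H b d)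

-- H has a proper (d + 1)-edge-colouring by Vizing's theorem (proved here by fan rotations and
-- Kempe-chain swaps), so each vertex b of the d-regular H misses exactly one colour μ b.  The
-- r − 1 colour classes of G′ − M are perfect matchings.  In the copy G × {b} the class of colour 0
-- is given μ b, while the other classes and the edges of M − X get fresh colours above d.  Every
-- vertex then sees all colours 0, …, d + r − 1, except that the ends of X-edges miss the colour of
-- M − X: two palettes.  One palette is impossible, since equal palettes force equal degrees and
-- G′ − X has vertices of degree r − 1 and r.

module Submission where

open import Defs
open import Data.Bool using (Bool; true; false; _∧_; _∨_; not; if_then_else_) renaming (_≟_ to _≟ᴮ_)
open import Data.Bool.Properties using (∨-zeroʳ; ∧-zeroʳ)
open import Data.Empty using (⊥; ⊥-elim)
import Data.Fin as Fin
open import Data.Fin using (Fin; toℕ; fromℕ<; _≟_)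
open import Data.Fin.Properties using (toℕ-fromℕ<; toℕ-injective; toℕ<n; any?; injective⇒≤)
open import Data.List using (List; []; _∷_; map; length; allFin; upTo; foldr; _++_; cartesianProduct)
open import Data.List.Membership.Propositional using (_∈_)
open import Data.List.Membership.Propositional.Properties
  using (∈-allFin; ∈-upTo⁺; ∈-cartesianProductWith⁺; ∈-map⁺; ∈-map⁻; ∈-++⁺ˡ; ∈-++⁺ʳ)
open import Data.List.Properties using (length-tabulate; length-upTo)
open import Data.List.Relation.Unary.All using (All; []; _∷_)
import Data.List.Relation.Unary.All as All
open import Data.List.Relation.Unary.AllPairs using (AllPairs; []; _∷_)
import Data.List.Relation.Unary.AllPairs as AllPairs
import Data.List.Relation.Unary.AllPairs.Properties as AllPairs
open import Data.List.Relation.Unary.Any using (here; there)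
open import Data.List.Relation.Unary.Unique.Propositional.Properties using (allFin⁺)
open import Data.Maybe using (Maybe; just; nothing; _>>=_)
open import Data.Maybe.Properties using (just-injective)
open import Data.Nat using (ℕ; zero; suc; _+_; _∸_; _≤_; _<_; z≤n; s≤s; _⊔_) renaming (_≟_ to _≟ℕ_)
open import Data.Nat.ListAction using (sum)
open import Data.Nat.Properties hiding (_≟_)
open import Algebra.Properties.CommutativeSemigroup +-commutativeSemigroup using (interchange)
open import Data.Product using (Σ; ∃; _×_; _,_; proj₁; proj₂)
open import Data.Product.Properties using (≡-dec)
open import Data.Sum using (_⊎_; inj₁; inj₂; [_,_]′)
open import Relation.Binary.Definitions using (DecidableEquality; tri<; tri≈; tri>)
open import Relation.Binary.PropositionalEquality
  using (_≡_; _≢_; refl; sym; trans; cong; cong₂; subst; module ≡-Reasoning)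
open import Relation.Nullary using (¬_; Dec; yes; no; does; _×-dec_)
open import Relation.Nullary.Decidable using (dec-true; dec-false; isYes≗does; map′; ⌊_⌋)

private variable A B : Set

-- Counting

-- deg K v is count (K v) (allFin _) by definition.
count : (A → Bool) → List A → ℕ
count p xs = sum (map (λ x → if p x then 1 else 0) xs)

indicator-mono : (b c : Bool) → (b ≡ true → c ≡ true) → (if b then 1 else 0) ≤ (if c then 1 else 0)
indicator-mono false c h = z≤n
indicator-mono true c h rewrite h refl = s≤s z≤n

count-mono : (p q : A → Bool) (xs : List A) →
  (∀ x → p x ≡ true → q x ≡ true) → count p xs ≤ count q xs
count-mono p q [] h = z≤n
count-mono p q (x ∷ xs) h = +-mono-≤ (indicator-mono (p x) (q x) (h x)) (count-mono p q xs h)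

count-cong : (p q : A → Bool) (xs : List A) → (∀ x → p x ≡ q x) → count p xs ≡ count q xs
count-cong p q xs h =
  ≤-antisym (count-mono p q xs (λ x e → trans (sym (h x)) e)) (count-mono q p xs (λ x e → trans (h x) e))

count-++ : (p : A → Bool) (xs ys : List A) → count p (xs ++ ys) ≡ count p xs + count p ys
count-++ p [] ys = refl
count-++ p (x ∷ xs) ys =
  trans (cong ((if p x then 1 else 0) +_) (count-++ p xs ys)) (sym (+-assoc (if p x then 1 else 0) (count p xs) (count p ys)))

count-map : (p : B → Bool) (f : A → B) (xs : List A) → count p (map f xs) ≡ count (λ x → p (f x)) xs
count-map p f [] = refl
count-map p f (x ∷ xs) = cong ((if p (f x) then 1 else 0) +_) (count-map p f xs)

count-+ : (p q s : A → Bool) (xs : List A) →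
  (∀ x → (if p x then 1 else 0) + (if q x then 1 else 0) ≡ (if s x then 1 else 0)) →
  count p xs + count q xs ≡ count s xs
count-+ p q s [] h = refl
count-+ p q s (x ∷ xs) h =
  trans (interchange (if p x then 1 else 0) (count p xs) (if q x then 1 else 0) (count q xs))
        (cong₂ _+_ (h x) (count-+ p q s xs h))

count-complement : (p : A → Bool) (xs : List A) → count p xs + count (λ x → not (p x)) xs ≡ length xs
count-complement p [] = refl
count-complement p (x ∷ xs) with p x
... | true = cong suc (count-complement p xs)
... | false = trans (+-suc _ _) (cong suc (count-complement p xs))

count-const-true : (xs : List A) → count (λ _ → true) xs ≡ length xs
count-const-true [] = refl
count-const-true (x ∷ xs) = cong suc (count-const-true xs)

count-pos⇒∃ : (p : A → Bool) (xs : List A) → 0 < count p xs → ∃ λ x → x ∈ xs × p x ≡ true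
count-pos⇒∃ p (x ∷ xs) h with p x in px
... | true = x , here refl , px
... | false with count-pos⇒∃ p xs h
... | y , y∈ , py = y , there y∈ , py

count-false : (p : A → Bool) (xs : List A) → (∀ x → p x ≡ false) → count p xs ≡ 0
count-false p [] h = refl
count-false p (x ∷ xs) h rewrite h x = count-false p xs h

module _ {B : Set} (_≟ᴮ_ : DecidableEquality B) where

  _without_ : (B → Bool) → B → B → Bool
  (q without y) z = q z ∧ not (does (z ≟ᴮ y))

  without-⊆ : (q : B → Bool) (y z : B) → (q without y) z ≡ true → q z ≡ true
  without-⊆ q y z h with q z
  ... | true = refl
  ... | false = h

  without-self : (q : B → Bool) (y : B) → (q without y) y ≡ false
  without-self q y rewrite dec-true (y ≟ᴮ y) refl with q y
  ... | true = refl
  ... | false = refl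

  without-other : (q : B → Bool) (y z : B) → q z ≡ true → z ≢ y → (q without y) z ≡ true
  without-other q y z qz z≢y rewrite dec-false (z ≟ᴮ y) z≢y | qz = refl

  count-without : (q : B → Bool) (y : B) (ys : List B) →
    y ∈ ys → q y ≡ true → suc (count (q without y) ys) ≤ count q ys
  count-without q y (z ∷ ys) (here refl) qy rewrite without-self q z | qy =
    s≤s (count-mono _ _ ys (without-⊆ q z))
  count-without q y (z ∷ ys) (there y∈) qy =
    ≤-trans (≤-reflexive (sym (+-suc _ _)))
      (+-mono-≤ (indicator-mono ((q without y) z) (q z) (without-⊆ q y z)) (count-without q y ys y∈ qy))

DistinctOn : (A → Bool) → A → A → Set
DistinctOn p a a′ = p a ≡ true → p a′ ≡ true → a ≢ a′

count-≤-injection : (_≟ᴮ_ : DecidableEquality B) (p : A → Bool) (q : B → Bool) (ψ : A → B)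
  (xs : List A) (ys : List B) →
  AllPairs (DistinctOn p) xs →
  All (λ a → p a ≡ true → (ψ a ∈ ys) × (q (ψ a) ≡ true)) xs →
  (∀ a a′ → p a ≡ true → p a′ ≡ true → ψ a ≡ ψ a′ → a ≡ a′) →
  count p xs ≤ count q ys
count-≤-injection _≟ᴮ_ p q ψ [] ys _ _ _ = z≤n
count-≤-injection _≟ᴮ_ p q ψ (x ∷ xs) ys (x-distinct ∷ distinct) (ψx ∷ ψxs) inj with p x in px
... | false = count-≤-injection _≟ᴮ_ p q ψ xs ys distinct ψxs inj
... | true =
  ≤-trans (s≤s (count-≤-injection _≟ᴮ_ p (_without_ _≟ᴮ_ q (ψ x)) ψ xs ys distinct (avoid xs (All.map (λ x≢ → x≢ refl) x-distinct) ψxs) inj))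
          (count-without _≟ᴮ_ q (ψ x) ys (proj₁ (ψx refl)) (proj₂ (ψx refl)))
  where
  avoid : (zs : List _) → All (λ a → p a ≡ true → x ≢ a) zs → All (λ a → p a ≡ true → (ψ a ∈ ys) × (q (ψ a) ≡ true)) zs →
          All (λ a → p a ≡ true → (ψ a ∈ ys) × (_without_ _≟ᴮ_ q (ψ x) (ψ a) ≡ true)) zs
  avoid [] [] [] = []
  avoid (z ∷ zs) (x≢z ∷ x≢zs) (ψz ∷ ψzs) =
    (λ pz → proj₁ (ψz pz) ,
            without-other _≟ᴮ_ q (ψ x) (ψ z) (proj₂ (ψz pz)) (λ e → x≢z pz (sym (inj z x pz px e))))
    ∷ avoid zs x≢zs ψzs

count-allFin-≤-injection : {a b : ℕ} (p : Fin a → Bool) (q : Fin b → Bool) (ψ : Fin a → Fin b) →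
  (∀ x → p x ≡ true → q (ψ x) ≡ true) → (∀ x x′ → p x ≡ true → p x′ ≡ true → ψ x ≡ ψ x′ → x ≡ x′) →
  count p (allFin a) ≤ count q (allFin b)
count-allFin-≤-injection p q ψ h inj = count-≤-injection _≟_ p q ψ (allFin _) (allFin _)
  (AllPairs.map (λ ne _ _ → ne) (allFin⁺ _)) (All.tabulate (λ {x} _ px → ∈-allFin (ψ x) , h x px)) inj

count-allFin-true : (a : ℕ) → count (λ _ → true) (allFin a) ≡ a
count-allFin-true a = trans (count-const-true (allFin a)) (length-tabulate (λ x → x))

count-+1≤length : (_≟ᴬ_ : DecidableEquality A) (p : A → Bool) (xs : List A) (j : A) →
  j ∈ xs → p j ≡ false → 1 + count p xs ≤ length xs
count-+1≤length _≟ᴬ_ p xs j j∈ pj = ≤-trans (≤-reflexive (+-comm 1 (count p xs)))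
  (≤-trans (+-monoʳ-≤ (count p xs) one≤) (≤-reflexive (count-complement p xs)))
  where
  one≤ : 1 ≤ count (λ x → not (p x)) xs
  one≤ = ≤-trans (s≤s z≤n) (count-without _≟ᴬ_ (λ x → not (p x)) j xs j∈ (cong not pj))

count-+2≤length : (_≟ᴬ_ : DecidableEquality A) (p : A → Bool) (xs : List A) (j j′ : A) → j ≢ j′ →
  j ∈ xs → j′ ∈ xs → p j ≡ false → p j′ ≡ false → 2 + count p xs ≤ length xs
count-+2≤length {A = A} _≟ᴬ_ p xs j j′ j≢j′ j∈ j′∈ pj pj′ = ≤-trans (≤-reflexive (+-comm 2 (count p xs)))
  (≤-trans (+-monoʳ-≤ (count p xs) two≤) (≤-reflexive (count-complement p xs)))
  where
  p̅ : A → Bool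
  p̅ x = not (p x)
  two≤ : 2 ≤ count p̅ xs
  two≤ = ≤-trans (s≤s (≤-trans (s≤s z≤n) (count-without _≟ᴬ_ (_without_ _≟ᴬ_ p̅ j) j′ xs j′∈
              (without-other _≟ᴬ_ p̅ j j′ (cong not pj′) (λ e → j≢j′ (sym e))))))
            (count-without _≟ᴬ_ p̅ j xs j∈ (cong not pj))

-- Decidable connectivity

module _ {m : ℕ} (F : Graph (Fin m)) where

  -- Linked k u v: u and v are joined by a walk in F all of whose inner vertices lie below k;
  -- growing k one vertex at a time (as in Floyd–Warshall) makes this decidable.
  data Linked (k : ℕ) : Fin m → Fin m → Set where
    linked-refl : ∀ {u} → Linked k u u
    linked-edge : ∀ {u v} → Adj F u v → Linked k u v
    linked-via : ∀ {u w v} → toℕ w < k → Linked k u w → Linked k w v → Linked k u v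

  Linked0-inv : ∀ {u v} → Linked 0 u v → (u ≡ v) ⊎ Adj F u v
  Linked0-inv linked-refl = inj₁ refl
  Linked0-inv (linked-edge e) = inj₂ e

  Linked-suc : ∀ {k u v} → Linked k u v → Linked (suc k) u v
  Linked-suc linked-refl = linked-refl
  Linked-suc (linked-edge e) = linked-edge e
  Linked-suc (linked-via lt p q) = linked-via (m≤n⇒m≤1+n lt) (Linked-suc p) (Linked-suc q)

  Linked-split : ∀ {k u v} (z : Fin m) → toℕ z ≡ k → Linked (suc k) u v →
    Linked k u v ⊎ (Linked k u z × Linked k z v)
  Linked-split z e linked-refl = inj₁ linked-refl
  Linked-split z e (linked-edge x) = inj₁ (linked-edge x)
  Linked-split {k} {u} {v} z e (linked-via {w = w} lt p q) with Linked-split z e p | Linked-split z e q | toℕ w ≟ℕ k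
  ... | p′ | q′ | yes w≡k = inj₂ (to-z p′ , from-z q′)
    where
    w≡z : w ≡ z
    w≡z = toℕ-injective (trans w≡k (sym e))
    to-z : Linked k u w ⊎ (Linked k u z × Linked k z w) → Linked k u z
    to-z (inj₁ x) = subst (Linked k u) w≡z x
    to-z (inj₂ (x , _)) = x
    from-z : Linked k w v ⊎ (Linked k w z × Linked k z v) → Linked k z v
    from-z (inj₁ x) = subst (λ t → Linked k t v) w≡z x
    from-z (inj₂ (_ , y)) = y
  ... | inj₁ p′ | inj₁ q′ | no w≢k = inj₁ (linked-via (≤∧≢⇒< (≤-pred lt) w≢k) p′ q′)
  ... | inj₁ p′ | inj₂ (q₁ , q₂) | no w≢k = inj₂ (linked-via (≤∧≢⇒< (≤-pred lt) w≢k) p′ q₁ , q₂)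
  ... | inj₂ (p₁ , p₂) | inj₁ q′ | no w≢k = inj₂ (p₁ , linked-via (≤∧≢⇒< (≤-pred lt) w≢k) p₂ q′)
  ... | inj₂ (p₁ , p₂) | inj₂ (q₁ , q₂) | no w≢k = inj₂ (p₁ , q₂)

  linked? : ∀ k → k ≤ m → ∀ u v → Dec (Linked k u v)
  linked? zero _ u v with u ≟ v | F u v in fuv
  ... | yes refl | _ = yes linked-refl
  ... | no _ | true = yes (linked-edge fuv)
  ... | no u≢v | false = no λ p → impossible (Linked0-inv p)
    where
    impossible : (u ≡ v) ⊎ Adj F u v → ⊥
    impossible (inj₁ e) = u≢v e
    impossible (inj₂ e) with trans (sym fuv) e
    ... | ()
  linked? (suc k) k<m u v with linked? k (<⇒≤ k<m) u v | linked? k (<⇒≤ k<m) u z | linked? k (<⇒≤ k<m) z v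
    where z = fromℕ< k<m
  ... | yes p | _ | _ = yes (Linked-suc p)
  ... | no _ | yes p | yes q = yes (linked-via (≤-reflexive (cong suc (toℕ-fromℕ< k<m))) (Linked-suc p) (Linked-suc q))
  ... | no ¬p | no ¬p₁ | _ = no λ r → [ ¬p , (λ pq → ¬p₁ (proj₁ pq)) ]′ (Linked-split _ (toℕ-fromℕ< k<m) r)
  ... | no ¬p | yes _ | no ¬p₂ = no λ r → [ ¬p , (λ pq → ¬p₂ (proj₂ pq)) ]′ (Linked-split _ (toℕ-fromℕ< k<m) r)

  Linked-trans : ∀ {u w v} → Linked m u w → Linked m w v → Linked m u v
  Linked-trans {w = w} = linked-via (toℕ<n w)

  Linked-sym : (∀ u v → F u v ≡ F v u) → ∀ {k u v} → Linked k u v → Linked k v u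
  Linked-sym s linked-refl = linked-refl
  Linked-sym s (linked-edge e) = linked-edge (trans (s _ _) e)
  Linked-sym s (linked-via lt p q) = linked-via lt (Linked-sym s q) (Linked-sym s p)

  Linked-closed : (P : Fin m → Set) → (∀ u v → P u → Adj F u v → P v) → ∀ {k u v} → Linked k u v → P u → P v
  Linked-closed P closed linked-refl pu = pu
  Linked-closed P closed (linked-edge e) pu = closed _ _ pu e
  Linked-closed P closed (linked-via lt p q) pu = Linked-closed P closed q (Linked-closed P closed p pu)

-- Degrees and palettes

Misses : {V : Set} → Graph V → (V → V → ℕ) → V → ℕ → Set
Misses K col v j = ∀ u → Adj K v u → col v u ≢ j

module _ {N : ℕ} (K : Graph (Fin N)) where

  inPalette? : (col : Fin N → Fin N → ℕ) (v : Fin N) (j : ℕ) → Dec (InPalette K col v j)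
  inPalette? col v j = any? (λ u → (K v u ≟ᴮ true) ×-dec (col v u ≟ℕ j))

  misses? : (col : Fin N → Fin N → ℕ) (v : Fin N) (j : ℕ) → Dec (Misses K col v j)
  misses? col v j with inPalette? col v j
  ... | yes (u , a , b) = no λ ms → ms u a b
  ... | no ¬in = yes λ u a b → ¬in (u , a , b)

  two-neighbours⇒2≤deg : ∀ a v w → Adj K a v → Adj K a w → v ≢ w → 2 ≤ deg K a
  two-neighbours⇒2≤deg a v w av aw v≢w =
    ≤-trans (s≤s (≤-trans (s≤s z≤n)
      (count-without _≟_ (_without_ _≟_ (K a) v) w (allFin N) (∈-allFin w)
         (without-other _≟_ (K a) v w aw (λ e → v≢w (sym e))))))
    (count-without _≟_ (K a) v (allFin N) (∈-allFin v) av)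

  deg≡1⇒neighbour-unique : ∀ a v w → deg K a ≡ 1 → Adj K a v → Adj K a w → v ≡ w
  deg≡1⇒neighbour-unique a v w d≡1 av aw with v ≟ w
  ... | yes e = e
  ... | no v≢w = ⊥-elim (<-irrefl refl (≤-trans (two-neighbours⇒2≤deg a v w av aw v≢w) (≤-reflexive d≡1)))

  deg-pos⇒neighbour : ∀ a → 0 < deg K a → ∃ λ v → Adj K a v
  deg-pos⇒neighbour a lt with count-pos⇒∃ (K a) (allFin N) lt
  ... | v , _ , av = v , av

  maxDeg≤ : ∀ c → (∀ v → deg K v ≤ c) → maxDeg K ≤ c
  maxDeg≤ c h = foldr-⊔≤ (allFin N) (All.tabulate (λ _ → h _))
    where
    foldr-⊔≤ : (xs : List (Fin N)) → All (λ v → deg K v ≤ c) xs → foldr _⊔_ 0 (map (deg K) xs) ≤ c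
    foldr-⊔≤ [] [] = z≤n
    foldr-⊔≤ (x ∷ xs) (px ∷ pxs) = ⊔-lub px (foldr-⊔≤ xs pxs)

  module _ (col : Fin N → Fin N → ℕ) (proper : IsProperEdgeColoring K col) (c : ℕ)
           (col<c : ∀ u v → Adj K u v → col u v < c) (a : Fin N) where

    deg≤palette-size : deg K a ≤ count (λ j → does (inPalette? col a j)) (upTo c)
    deg≤palette-size = count-≤-injection _≟ℕ_ (K a) _ (col a) (allFin N) (upTo c)
      (AllPairs.map (λ ne _ _ → ne) (allFin⁺ N))
      (All.tabulate (λ {v} _ av → ∈-upTo⁺ (col<c a v av) , dec-true (inPalette? col a (col a v)) (v , av , refl)))
      (proj₂ proper a)

    misses⇒1+deg≤ : ∀ j → j < c → Misses K col a j → 1 + deg K a ≤ c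
    misses⇒1+deg≤ j j<c ms = ≤-trans (s≤s deg≤palette-size)
      (≤-trans (count-+1≤length _≟ℕ_ _ (upTo c) j (∈-upTo⁺ j<c)
                  (dec-false (inPalette? col a j) λ (u , au , e) → ms u au e))
               (≤-reflexive (length-upTo c)))

    misses-two⇒2+deg≤ : ∀ j j′ → j ≢ j′ → j < c → j′ < c → Misses K col a j → Misses K col a j′ → 2 + deg K a ≤ c
    misses-two⇒2+deg≤ j j′ j≢j′ j<c j′<c ms ms′ = ≤-trans (s≤s (s≤s deg≤palette-size))
      (≤-trans (count-+2≤length _≟ℕ_ _ (upTo c) j j′ j≢j′ (∈-upTo⁺ j<c) (∈-upTo⁺ j′<c)
                  (dec-false (inPalette? col a j) λ (u , au , e) → ms u au e)
                  (dec-false (inPalette? col a j′) λ (u , au , e) → ms′ u au e))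
               (≤-reflexive (length-upTo c)))

    deg≡⇒inPalette : deg K a ≡ c → ∀ j → j < c → InPalette K col a j
    deg≡⇒inPalette deg≡c j j<c with inPalette? col a j
    ... | yes p = p
    ... | no ¬p = ⊥-elim (<-irrefl refl (≤-trans (≤-reflexive (cong suc (sym deg≡c)))
                    (misses⇒1+deg≤ j j<c (λ u au e → ¬p (u , au , e)))))

    1+deg≡⇒inPalette-except : 1 + deg K a ≡ c → ∀ μ → μ < c → Misses K col a μ →
      ∀ j → j < c → j ≢ μ → InPalette K col a j
    1+deg≡⇒inPalette-except 1+deg≡c μ μ<c msμ j j<c j≢μ with inPalette? col a j
    ... | yes p = p
    ... | no ¬p = ⊥-elim (<-irrefl refl (≤-trans (≤-reflexive (cong suc (sym 1+deg≡c)))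
                    (misses-two⇒2+deg≤ j μ j≢μ j<c μ<c (λ u au e → ¬p (u , au , e)) msμ)))

  deg<⇒misses-colour : (col : Fin N → Fin N → ℕ) → ∀ c v → deg K v < c → Σ ℕ λ j → j < c × Misses K col v j
  deg<⇒misses-colour col c v deg<c with any? {P = λ (j : Fin c) → Misses K col v (toℕ j)} (λ j → misses? col v (toℕ j))
  ... | yes (j , ms) = toℕ j , toℕ<n j , ms
  ... | no ¬ms = ⊥-elim (<-irrefl refl (≤-trans deg<c c≤deg))
    where
    witness : (j : Fin c) → InPalette K col v (toℕ j)
    witness j with inPalette? col v (toℕ j)
    ... | yes p = p
    ... | no ¬p = ⊥-elim (¬ms (j , λ u vu e → ¬p (u , vu , e)))
    c≤deg : c ≤ deg K v
    c≤deg = ≤-trans (≤-reflexive (sym (count-allFin-true c)))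
      (count-allFin-≤-injection (λ _ → true) (K v) (λ j → proj₁ (witness j)) (λ j _ → proj₁ (proj₂ (witness j)))
        (λ j j′ _ _ e → toℕ-injective (trans (sym (proj₂ (proj₂ (witness j))))
          (trans (cong (col v) e) (proj₂ (proj₂ (witness j′)))))))

deg-∖-+ : {N : ℕ} (G K : Graph (Fin N)) → (∀ a v → Adj K a v → Adj G a v) → ∀ a → deg (G ∖ K) a + deg K a ≡ deg G a
deg-∖-+ {N} G K K⊆G a = count-+ _ _ _ (allFin N) pointwise
  where
  pointwise : ∀ u → (if (G ∖ K) a u then 1 else 0) + (if K a u then 1 else 0) ≡ (if G a u then 1 else 0)
  pointwise u with K a u in e
  ... | true rewrite K⊆G a u e = refl
  ... | false with G a u
  ...   | true = refl
  ...   | false = refl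

bool-≡ : (a b : Bool) → (a ≡ true → b ≡ true) → (b ≡ true → a ≡ true) → a ≡ b
bool-≡ false false _ _ = refl
bool-≡ false true _ h = h refl
bool-≡ true false h _ = sym (h refl)
bool-≡ true true _ _ = refl

false≢true : false ≢ true
false≢true ()

does-true⇒ : (a? : Dec A) → does a? ≡ true → A
does-true⇒ (yes a) _ = a

-- Vizing's theorem

-- The edges of H are added one at a time, each time repairing a proper (Δ + 1)-colouring as in
-- the Misra–Gries proof.
module Vizing {m : ℕ} (H : Graph (Fin m)) (H-sym : ∀ u v → H u v ≡ H v u) (H-irrefl : ∀ u → H u u ≡ false)
  (Δ : ℕ) (deg≤Δ : ∀ v → deg H v ≤ Δ) where

  V : Set
  V = Fin m

  Colouring : Set
  Colouring = V → V → ℕ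

  k : ℕ
  k = suc Δ

  Subgraph : Graph V → Set
  Subgraph K = ∀ u v → Adj K u v → Adj H u v

  Symmetric : Graph V → Set
  Symmetric K = ∀ u v → K u v ≡ K v u

  record ProperColouring (K : Graph V) : Set where
    field
      col : Colouring
      proper : IsProperEdgeColoring K col
      col<k : ∀ u v → Adj K u v → col u v < k

  subgraph-irrefl : (K : Graph V) → Subgraph K → ∀ u → ¬ Adj K u u
  subgraph-irrefl K K⊆H u e = false≢true (trans (sym (H-irrefl u)) (K⊆H u u e))

  subgraph-adj⇒≢ : (K : Graph V) → Subgraph K → ∀ u v → Adj K u v → u ≢ v
  subgraph-adj⇒≢ K K⊆H u v e refl = subgraph-irrefl K K⊆H u e

  missing-colour : (K : Graph V) → Subgraph K → (col : Colouring) → (v : V) → Σ ℕ λ j → j < k × Misses K col v j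
  missing-colour K K⊆H col v =
    deg<⇒misses-colour K col k v (s≤s (≤-trans (count-mono (K v) (H v) (allFin m) (K⊆H v)) (deg≤Δ v)))

  addEdge : Graph V → V → V → Graph V
  addEdge K x y u v = K u v ∨ ((does (u ≟ x) ∧ does (v ≟ y)) ∨ (does (u ≟ y) ∧ does (v ≟ x)))

  addEdge-inv : ∀ K x y u v → Adj (addEdge K x y) u v → Adj K u v ⊎ ((u ≡ x × v ≡ y) ⊎ (u ≡ y × v ≡ x))
  addEdge-inv K x y u v e with K u v | u ≟ x | v ≟ y | u ≟ y | v ≟ x
  ... | true | _ | _ | _ | _ = inj₁ refl
  ... | false | yes a | yes b | _ | _ = inj₂ (inj₁ (a , b))
  ... | false | _ | _ | yes a | yes b = inj₂ (inj₂ (a , b))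
  ... | false | no _ | _ | no _ | _ = ⊥-elim (false≢true e)
  ... | false | no _ | _ | yes _ | no _ = ⊥-elim (false≢true e)
  ... | false | yes _ | no _ | no _ | _ = ⊥-elim (false≢true e)
  ... | false | yes _ | no _ | yes _ | no _ = ⊥-elim (false≢true e)

  addEdge-⊇ : ∀ K x y u v → Adj K u v → Adj (addEdge K x y) u v
  addEdge-⊇ K x y u v e rewrite e = refl

  addEdge-new : ∀ K x y → Adj (addEdge K x y) x y
  addEdge-new K x y rewrite dec-true (x ≟ x) refl | dec-true (y ≟ y) refl = ∨-zeroʳ (K x y)

  addEdge-new′ : ∀ K x y → Adj (addEdge K x y) y x
  addEdge-new′ K x y rewrite dec-true (x ≟ x) refl | dec-true (y ≟ y) refl =
    trans (cong (K y x ∨_) (∨-zeroʳ (does (y ≟ x) ∧ does (x ≟ y)))) (∨-zeroʳ (K y x))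

  addEdge-subgraph : ∀ K x y → Subgraph K → Adj H x y → Subgraph (addEdge K x y)
  addEdge-subgraph K x y K⊆H Hxy u v e with addEdge-inv K x y u v e
  ... | inj₁ a = K⊆H u v a
  ... | inj₂ (inj₁ (refl , refl)) = Hxy
  ... | inj₂ (inj₂ (refl , refl)) = trans (H-sym y x) Hxy

  addEdge-sym : ∀ K x y → Symmetric K → Symmetric (addEdge K x y)
  addEdge-sym K x y K-sym u v = bool-≡ _ _ (flip u v) (flip v u)
    where
    flip : ∀ u v → Adj (addEdge K x y) u v → Adj (addEdge K x y) v u
    flip u v e with addEdge-inv K x y u v e
    ... | inj₁ a = addEdge-⊇ K x y v u (trans (K-sym v u) a)
    ... | inj₂ (inj₁ (refl , refl)) = addEdge-new′ K x y
    ... | inj₂ (inj₂ (refl , refl)) = addEdge-new K x y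

  record Fan (K : Graph V) (col : Colouring) (x y₀ : V) (β : V → ℕ) (T : ℕ) (y : ℕ → V) : Set where
    field
      start : y 0 ≡ y₀
      injective : ∀ i j → i ≤ T → j ≤ T → y i ≡ y j → i ≡ j
      chain : ∀ i → i < T → Adj K x (y (suc i)) × col x (y (suc i)) ≡ β (y i)

  -- Rotating the fan: each edge x (y i) takes the colour missing at y i (γ for the last one),
  -- which frees the colour of x (y (i+1)) and so leaves room for the new edge x y₀.
  module FanRotation (K : Graph V) (K⊆H : Subgraph K) (K-sym : Symmetric K) (pc : ProperColouring K)
    (x y₀ : V) (Hxy₀ : Adj H x y₀) (β : V → ℕ) (β<k : ∀ v → β v < k)
    (T : ℕ) (y : ℕ → V) (fan : Fan K (ProperColouring.col pc) x y₀ β T y)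
    (β-missing : ∀ i → i < T → Misses K (ProperColouring.col pc) (y i) (β (y i)))
    (γ : ℕ) (γ<k : γ < k) (γ-x : Misses K (ProperColouring.col pc) x γ)
    (γ-end : Misses K (ProperColouring.col pc) (y T) γ) where

    open ProperColouring pc
    open Fan fan

    InFan : V → Set
    InFan v = ∃ λ i → i ≤ T × y i ≡ v

    inFan? : (v : V) → Dec (InFan v)
    inFan? v = map′ (λ (i , i<1+T , e) → i , ≤-pred i<1+T , e) (λ (i , i≤T , e) → i , s≤s i≤T , e)
                    (anyUpTo? (λ i → y i ≟ v) (suc T))

    σ : V → ℕ
    σ v with v ≟ y T
    ... | yes _ = γ
    ... | no _ = β v

    σ<k : ∀ v → σ v < k
    σ<k v with v ≟ y T
    ... | yes _ = γ<k
    ... | no _ = β<k v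

    inner : ∀ v → InFan v → v ≢ y T → ∃ λ i → i < T × y i ≡ v
    inner v (i , i≤T , e) v≢end with i ≟ℕ T
    ... | yes refl = ⊥-elim (v≢end (sym e))
    ... | no i≢T = i , ≤∧≢⇒< i≤T i≢T , e

    σ-missing : ∀ v → InFan v → Misses K col v (σ v)
    σ-missing v v∈ with v ≟ y T
    ... | yes refl = γ-end
    ... | no v≢end with inner v v∈ v≢end
    ...   | i , i<T , refl = β-missing i i<T

    y₀∈ : InFan y₀
    y₀∈ = 0 , z≤n , start

    σ-unused-at-x : ∀ v w → InFan v → Adj K x w → ¬ InFan w → σ v ≢ col x w
    σ-unused-at-x v w v∈ xw w∉ e with v ≟ y T
    ... | yes _ = γ-x w xw (sym e)
    ... | no v≢end with inner v v∈ v≢end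
    ...   | i , i<T , refl =
      w∉ (suc i , i<T , proj₂ proper x _ _ (proj₁ (chain i i<T)) xw (trans (proj₂ (chain i i<T)) e))

    σ-injective : ∀ v w → InFan v → InFan w → σ v ≡ σ w → v ≡ w
    σ-injective v w v∈ w∈ e with v ≟ y T | w ≟ y T
    ... | yes a | yes b = trans a (sym b)
    ... | yes a | no b with inner w w∈ b
    ...   | i , i<T , refl = ⊥-elim (γ-x _ (proj₁ (chain i i<T)) (trans (proj₂ (chain i i<T)) (sym e)))
    σ-injective v w v∈ w∈ e | no a | yes b with inner v v∈ a
    ...   | i , i<T , refl = ⊥-elim (γ-x _ (proj₁ (chain i i<T)) (trans (proj₂ (chain i i<T)) e))
    σ-injective v w v∈ w∈ e | no a | no b with inner v v∈ a | inner w w∈ b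
    ...   | i , i<T , refl | j , j<T , refl
          with injective (suc i) (suc j) i<T j<T
                 (proj₂ proper x _ _ (proj₁ (chain i i<T)) (proj₁ (chain j j<T))
                   (trans (proj₂ (chain i i<T)) (trans e (sym (proj₂ (chain j j<T))))))
    ...     | refl = refl

    K′ : Graph V
    K′ = addEdge K x y₀

    K′⊆H : Subgraph K′
    K′⊆H = addEdge-subgraph K x y₀ K⊆H Hxy₀

    K′-away : ∀ u v → u ≢ x → v ≢ x → Adj K′ u v → Adj K u v
    K′-away u v u≢x v≢x e with addEdge-inv K x y₀ u v e
    ... | inj₁ a = a
    ... | inj₂ (inj₁ (a , _)) = ⊥-elim (u≢x a)
    ... | inj₂ (inj₂ (_ , b)) = ⊥-elim (v≢x b)

    K′-at-x : ∀ v → Adj K′ x v → ¬ InFan v → Adj K x v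
    K′-at-x v e v∉ with addEdge-inv K x y₀ x v e
    ... | inj₁ a = a
    ... | inj₂ (inj₁ (_ , refl)) = ⊥-elim (v∉ y₀∈)
    ... | inj₂ (inj₂ (_ , refl)) = ⊥-elim (subgraph-irrefl K′ K′⊆H x e)

    K′-flip : ∀ u → Adj K′ u x → Adj K′ x u
    K′-flip u e = trans (addEdge-sym K x y₀ K-sym x u) e

    at-x : V → ℕ
    at-x v with inFan? v
    ... | yes _ = σ v
    ... | no _ = col x v

    col′ : Colouring
    col′ u v with u ≟ x | v ≟ x
    ... | yes _ | _ = at-x v
    ... | no _ | yes _ = at-x u
    ... | no _ | no _ = col u v

    col′-x : ∀ u v → u ≡ x → col′ u v ≡ at-x v
    col′-x u v u≡x with u ≟ x
    ... | yes _ = refl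
    ... | no u≢x = ⊥-elim (u≢x u≡x)

    col′-·x : ∀ u v → u ≢ x → v ≡ x → col′ u v ≡ at-x u
    col′-·x u v u≢x v≡x with u ≟ x | v ≟ x
    ... | yes u≡x | _ = ⊥-elim (u≢x u≡x)
    ... | no _ | yes _ = refl
    ... | no _ | no v≢x = ⊥-elim (v≢x v≡x)

    col′-away : ∀ u v → u ≢ x → v ≢ x → col′ u v ≡ col u v
    col′-away u v u≢x v≢x with u ≟ x | v ≟ x
    ... | yes u≡x | _ = ⊥-elim (u≢x u≡x)
    ... | no _ | yes v≡x = ⊥-elim (v≢x v≡x)
    ... | no _ | no _ = refl

    col′-sym : ∀ u v → Adj K′ u v → col′ u v ≡ col′ v u
    col′-sym u v e = by-cases (u ≟ x) (v ≟ x)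
      where
      by-cases : Dec (u ≡ x) → Dec (v ≡ x) → col′ u v ≡ col′ v u
      by-cases (yes u≡x) _ = trans (col′-x u v u≡x) (sym (col′-·x v u v≢x u≡x))
        where
        v≢x : v ≢ x
        v≢x v≡x = subgraph-adj⇒≢ K′ K′⊆H u v e (trans u≡x (sym v≡x))
      by-cases (no u≢x) (yes v≡x) = trans (col′-·x u v u≢x v≡x) (sym (col′-x v u v≡x))
      by-cases (no u≢x) (no v≢x) =
        trans (col′-away u v u≢x v≢x) (trans (proj₁ proper u v (K′-away u v u≢x v≢x e)) (sym (col′-away v u v≢x u≢x)))

    at-x-injective : ∀ v w → Adj K′ x v → Adj K′ x w → at-x v ≡ at-x w → v ≡ w
    at-x-injective v w xv xw e with inFan? v | inFan? w
    ... | yes v∈ | yes w∈ = σ-injective v w v∈ w∈ e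
    ... | yes v∈ | no w∉ = ⊥-elim (σ-unused-at-x v w v∈ (K′-at-x w xw w∉) w∉ e)
    ... | no v∉ | yes w∈ = ⊥-elim (σ-unused-at-x w v w∈ (K′-at-x v xv v∉) v∉ (sym e))
    ... | no v∉ | no w∉ = proj₂ proper x v w (K′-at-x v xv v∉) (K′-at-x w xw w∉) e

    at-x-fresh : ∀ u w → u ≢ x → w ≢ x → Adj K′ u x → Adj K′ u w → at-x u ≢ col u w
    at-x-fresh u w u≢x w≢x ux uw e with inFan? u
    ... | yes u∈ = σ-missing u u∈ w (K′-away u w u≢x w≢x uw) (sym e)
    ... | no u∉ = w≢x (sym (proj₂ proper u x w (trans (K-sym u x) xu) (K′-away u w u≢x w≢x uw)
                    (trans (sym (proj₁ proper x u xu)) e)))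
      where
      xu : Adj K x u
      xu = K′-at-x u (K′-flip u ux) u∉

    col′-injective : ∀ u v w → Adj K′ u v → Adj K′ u w → col′ u v ≡ col′ u w → v ≡ w
    col′-injective u v w uv uw e = by-cases (u ≟ x) (v ≟ x) (w ≟ x)
      where
      by-cases : Dec (u ≡ x) → Dec (v ≡ x) → Dec (w ≡ x) → v ≡ w
      by-cases (yes u≡x) _ _ =
        at-x-injective v w (subst (λ t → Adj K′ t v) u≡x uv) (subst (λ t → Adj K′ t w) u≡x uw)
          (trans (sym (col′-x u v u≡x)) (trans e (col′-x u w u≡x)))
      by-cases (no u≢x) (yes v≡x) (yes w≡x) = trans v≡x (sym w≡x)
      by-cases (no u≢x) (yes v≡x) (no w≢x) =
        ⊥-elim (at-x-fresh u w u≢x w≢x (subst (Adj K′ u) v≡x uv) uw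
          (trans (sym (col′-·x u v u≢x v≡x)) (trans e (col′-away u w u≢x w≢x))))
      by-cases (no u≢x) (no v≢x) (yes w≡x) =
        ⊥-elim (at-x-fresh u v u≢x v≢x (subst (Adj K′ u) w≡x uw) uv
          (trans (sym (col′-·x u w u≢x w≡x)) (trans (sym e) (col′-away u v u≢x v≢x))))
      by-cases (no u≢x) (no v≢x) (no w≢x) =
        proj₂ proper u v w (K′-away u v u≢x v≢x uv) (K′-away u w u≢x w≢x uw)
          (trans (sym (col′-away u v u≢x v≢x)) (trans e (col′-away u w u≢x w≢x)))

    at-x<k : ∀ v → Adj K′ x v → at-x v < k
    at-x<k v xv with inFan? v
    ... | yes _ = σ<k v
    ... | no v∉ = col<k x v (K′-at-x v xv v∉)

    col′<k : ∀ u v → Adj K′ u v → col′ u v < k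
    col′<k u v e = by-cases (u ≟ x) (v ≟ x)
      where
      by-cases : Dec (u ≡ x) → Dec (v ≡ x) → col′ u v < k
      by-cases (yes u≡x) _ = subst (_< k) (sym (col′-x u v u≡x)) (at-x<k v (subst (λ t → Adj K′ t v) u≡x e))
      by-cases (no u≢x) (yes v≡x) = subst (_< k) (sym (col′-·x u v u≢x v≡x)) (at-x<k u (K′-flip u (subst (Adj K′ u) v≡x e)))
      by-cases (no u≢x) (no v≢x) = subst (_< k) (sym (col′-away u v u≢x v≢x)) (col<k u v (K′-away u v u≢x v≢x e))

    rotated : ProperColouring K′
    rotated = record { col = col′ ; proper = col′-sym , col′-injective ; col<k = col′<k }

  module KempeSwap (K : Graph V) (K-sym : Symmetric K) (pc : ProperColouring K)
    (α β : ℕ) (α<k : α < k) (β<k : β < k) (Z : V → Bool)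
    (Z-closed : ∀ u v → Z u ≡ true → Adj K u v →
                (ProperColouring.col pc u v ≡ α) ⊎ (ProperColouring.col pc u v ≡ β) → Z v ≡ true) where

    open ProperColouring pc

    transpose : ℕ → ℕ
    transpose c = if does (c ≟ℕ α) then β else if does (c ≟ℕ β) then α else c

    transpose-other : ∀ c → c ≢ α → c ≢ β → transpose c ≡ c
    transpose-other c c≢α c≢β rewrite dec-false (c ≟ℕ α) c≢α | dec-false (c ≟ℕ β) c≢β = refl

    transpose-α : transpose α ≡ β
    transpose-α rewrite dec-true (α ≟ℕ α) refl = refl

    transpose-β : transpose β ≡ α
    transpose-β with β ≟ℕ α
    ... | yes β≡α rewrite dec-true (β ≟ℕ α) β≡α = β≡α
    ... | no β≢α rewrite dec-false (β ≟ℕ α) β≢α | dec-true (β ≟ℕ β) refl = refl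

    transpose-involutive : ∀ c → transpose (transpose c) ≡ c
    transpose-involutive c with c ≟ℕ α | c ≟ℕ β
    ... | yes refl | _ = trans (cong transpose transpose-α) transpose-β
    ... | no _ | yes refl = trans (cong transpose transpose-β) transpose-α
    ... | no c≢α | no c≢β = trans (cong transpose (transpose-other c c≢α c≢β)) (transpose-other c c≢α c≢β)

    transpose-injective : ∀ a b → transpose a ≡ transpose b → a ≡ b
    transpose-injective a b e = trans (sym (transpose-involutive a)) (trans (cong transpose e) (transpose-involutive b))

    transpose<k : ∀ c → c < k → transpose c < k
    transpose<k c c<k with does (c ≟ℕ α) | does (c ≟ℕ β)
    ... | true | _ = β<k
    ... | false | true = α<k
    ... | false | false = c<k

    col′ : Colouring
    col′ u v = if Z u then transpose (col u v) else col u v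

    col′-outside : ∀ u v → Z u ≡ false → col′ u v ≡ col u v
    col′-outside u v Zu rewrite Zu = refl

    Z-edge : ∀ u v → Adj K u v → (col u v ≡ α) ⊎ (col u v ≡ β) → Z u ≡ Z v
    Z-edge u v e c = bool-≡ _ _ (λ Zu → Z-closed u v Zu e c)
      (λ Zv → Z-closed v u Zv (trans (K-sym v u) e) (subst (λ t → (t ≡ α) ⊎ (t ≡ β)) (proj₁ proper u v e) c))

    if-transpose-other : ∀ b c → c ≢ α → c ≢ β → (if b then transpose c else c) ≡ c
    if-transpose-other true c c≢α c≢β = transpose-other c c≢α c≢β
    if-transpose-other false c c≢α c≢β = refl

    col′-sym : ∀ u v → Adj K u v → col′ u v ≡ col′ v u
    col′-sym u v e with col u v ≟ℕ α | col u v ≟ℕ β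
    ... | yes c≡α | _ = same-side (Z-edge u v e (inj₁ c≡α))
      where
      same-side : Z u ≡ Z v → col′ u v ≡ col′ v u
      same-side Zu≡Zv rewrite Zu≡Zv | proj₁ proper u v e = refl
    ... | no _ | yes c≡β = same-side (Z-edge u v e (inj₂ c≡β))
      where
      same-side : Z u ≡ Z v → col′ u v ≡ col′ v u
      same-side Zu≡Zv rewrite Zu≡Zv | proj₁ proper u v e = refl
    ... | no c≢α | no c≢β =
      trans (if-transpose-other (Z u) (col u v) c≢α c≢β)
        (trans (proj₁ proper u v e)
          (sym (if-transpose-other (Z v) (col v u) (λ c≡ → c≢α (trans (proj₁ proper u v e) c≡))
                                                  (λ c≡ → c≢β (trans (proj₁ proper u v e) c≡)))))

    col′-injective : ∀ u v w → Adj K u v → Adj K u w → col′ u v ≡ col′ u w → v ≡ w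
    col′-injective u v w uv uw e with Z u
    ... | true = proj₂ proper u v w uv uw (transpose-injective _ _ e)
    ... | false = proj₂ proper u v w uv uw e

    col′<k : ∀ u v → Adj K u v → col′ u v < k
    col′<k u v e with Z u
    ... | true = transpose<k _ (col<k u v e)
    ... | false = col<k u v e

    swapped : ProperColouring K
    swapped = record { col = col′ ; proper = col′-sym , col′-injective ; col<k = col′<k }

    misses-outside : ∀ u j → Z u ≡ false → Misses K col u j → Misses K col′ u j
    misses-outside u j Zu ms v e c = ms v e (trans (sym (col′-outside u v Zu)) c)

    misses-inside : ∀ u → Z u ≡ true → Misses K col u β → Misses K col′ u α
    misses-inside u Zu ms v e c rewrite Zu =
      ms v e (trans (sym (transpose-involutive (col u v))) (trans (cong transpose c) transpose-α))

    misses-other : ∀ u j → j ≢ α → j ≢ β → Misses K col u j → Misses K col′ u j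
    misses-other u j j≢α j≢β ms v e c with Z u
    ... | true = ms v e (trans (sym (transpose-involutive (col u v))) (trans (cong transpose c) (transpose-other j j≢α j≢β)))
    ... | false = ms v e c

  bicoloured : Graph V → Colouring → ℕ → ℕ → Graph V
  bicoloured K col α β u v = K u v ∧ (does (col u v ≟ℕ α) ∨ does (col u v ≟ℕ β))

  bicoloured-inv : ∀ K col α β u v → Adj (bicoloured K col α β) u v → Adj K u v × ((col u v ≡ α) ⊎ (col u v ≡ β))
  bicoloured-inv K col α β u v e with K u v | does (col u v ≟ℕ α) in cα | does (col u v ≟ℕ β) in cβ
  ... | true | true | _ = refl , inj₁ (does-true⇒ (col u v ≟ℕ α) cα)
  ... | true | false | true = refl , inj₂ (does-true⇒ (col u v ≟ℕ β) cβ)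

  bicoloured-intro : ∀ K col α β u v → Adj K u v → ((col u v ≡ α) ⊎ (col u v ≡ β)) → Adj (bicoloured K col α β) u v
  bicoloured-intro K col α β u v e (inj₁ c≡α) rewrite e | dec-true (col u v ≟ℕ α) c≡α = refl
  bicoloured-intro K col α β u v e (inj₂ c≡β) rewrite e | dec-true (col u v ≟ℕ β) c≡β = ∨-zeroʳ _

  bicoloured-sym : ∀ K col α β → Symmetric K → (∀ u v → Adj K u v → col u v ≡ col v u) → Symmetric (bicoloured K col α β)
  bicoloured-sym K col α β K-sym col-sym u v = bool-≡ _ _ (flip u v) (flip v u)
    where
    flip : ∀ u v → Adj (bicoloured K col α β) u v → Adj (bicoloured K col α β) v u
    flip u v e with bicoloured-inv K col α β u v e
    ... | uv , c = bicoloured-intro K col α β v u (trans (K-sym v u) uv) (subst (λ t → (t ≡ α) ⊎ (t ≡ β)) (col-sym u v uv) c)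

  -- In a proper colouring, the α/β-coloured edges form paths and cycles. Starting at p, which
  -- misses α, the walk that follows β, α, β, … is a path that visits p's whole α/β-component, and
  -- any other vertex of that component missing α or β is its far end; so there is at most one.
  module AlternatingPath (K : Graph V) (K-sym : Symmetric K) (col : Colouring) (proper : IsProperEdgeColoring K col)
    (α β : ℕ) (α≢β : α ≢ β) (p : V) (p-misses-α : Misses K col p α) where

    next : ℕ → V → Maybe V
    next c v with inPalette? K col v c
    ... | yes (u , _) = just u
    ... | no _ = nothing

    next-spec : ∀ c v → (∃ λ u → next c v ≡ just u × Adj K v u × col v u ≡ c) ⊎ (next c v ≡ nothing × Misses K col v c)
    next-spec c v with inPalette? K col v c
    ... | yes (u , vu , e) = inj₁ (u , refl , vu , e)
    ... | no ¬in = inj₂ (refl , λ u vu e → ¬in (u , vu , e))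

    next-sound : ∀ c v u → next c v ≡ just u → Adj K v u × col v u ≡ c
    next-sound c v u e with next-spec c v
    ... | inj₁ (u′ , e′ , vu , cu) with trans (sym e′) e
    ...   | refl = vu , cu
    next-sound c v u e | inj₂ (e′ , _) with trans (sym e′) e
    ... | ()

    next-complete : ∀ c v u → Adj K v u → col v u ≡ c → next c v ≡ just u
    next-complete c v u vu cu with next-spec c v
    ... | inj₁ (u′ , e′ , vu′ , cu′) = trans e′ (cong just (proj₂ proper v u′ u vu′ vu (trans cu′ (sym cu))))
    ... | inj₂ (_ , ms) = ⊥-elim (ms u vu cu)

    next-end : ∀ c v → Misses K col v c → next c v ≡ nothing
    next-end c v ms with next-spec c v
    ... | inj₁ (u′ , _ , vu′ , cu′) = ⊥-elim (ms u′ vu′ cu′)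
    ... | inj₂ (e , _) = e

    other : ℕ → ℕ
    other c = if does (c ≟ℕ β) then α else β

    colour : ℕ → ℕ
    colour zero = β
    colour (suc i) = other (colour i)

    colour-alternates : ∀ i → (colour i ≡ β × colour (suc i) ≡ α) ⊎ (colour i ≡ α × colour (suc i) ≡ β)
    colour-alternates zero rewrite dec-true (β ≟ℕ β) refl = inj₁ (refl , refl)
    colour-alternates (suc i) with colour-alternates i
    ... | inj₁ (_ , cα) rewrite cα | dec-false (α ≟ℕ β) α≢β = inj₂ (refl , refl)
    ... | inj₂ (_ , cβ) rewrite cβ | dec-true (β ≟ℕ β) refl = inj₁ (refl , refl)

    walk : ℕ → Maybe V
    walk zero = just p
    walk (suc i) = walk i >>= next (colour i)

    walk-stopped : ∀ i j → i ≤ j → walk i ≡ nothing → walk j ≡ nothing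
    walk-stopped i j i≤j stop with m≤n⇒m<n∨m≡n i≤j
    ... | inj₂ refl = stop
    walk-stopped i (suc j) i≤j stop | inj₁ i<1+j rewrite walk-stopped i j (≤-pred i<1+j) stop = refl

    walk-step : ∀ i u → walk i ≡ just u → walk (suc i) ≡ next (colour i) u
    walk-step i u e rewrite e = refl

    walk-back : ∀ i v → walk (suc i) ≡ just v → ∃ λ u → walk i ≡ just u × Adj K u v × col u v ≡ colour i
    walk-back i v e with walk i in wi
    ... | nothing with e
    ...   | ()
    walk-back i v e | just u = u , refl , next-sound (colour i) u v e

    OnWalk : V → Set
    OnWalk v = ∃ λ i → walk i ≡ just v

    -- The α/β-neighbour of a walk vertex is its successor or, by properness, its predecessor.
    OnWalk-closed : ∀ u v → OnWalk u → Adj (bicoloured K col α β) u v → OnWalk v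
    OnWalk-closed u v (i , wi) e with bicoloured-inv K col α β u v e
    ... | uv , c with col u v ≟ℕ colour i
    ...   | yes c≡ = suc i , trans (walk-step i u wi) (next-complete (colour i) u v uv c≡)
    ...   | no c≢ with i
    ...     | zero with just-injective wi | c
    ...       | refl | inj₁ c≡α = ⊥-elim (p-misses-α v uv c≡α)
    ...       | refl | inj₂ c≡β = ⊥-elim (c≢ c≡β)
    OnWalk-closed u v (i , wi) e | uv , c | no c≢ | suc i′ with walk-back i′ u wi
    ... | u′ , wi′ , u′u , cu′u = i′ , trans wi′ (cong just (sym v≡u′))
      where
      previous-colour : (col u v ≡ α) ⊎ (col u v ≡ β) →
        (colour i′ ≡ β × colour (suc i′) ≡ α) ⊎ (colour i′ ≡ α × colour (suc i′) ≡ β) → col u v ≡ colour i′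
      previous-colour (inj₁ c≡α) (inj₁ (_ , c′≡α)) = ⊥-elim (c≢ (trans c≡α (sym c′≡α)))
      previous-colour (inj₁ c≡α) (inj₂ (c≡α′ , _)) = trans c≡α (sym c≡α′)
      previous-colour (inj₂ c≡β) (inj₁ (c≡β′ , _)) = trans c≡β (sym c≡β′)
      previous-colour (inj₂ c≡β) (inj₂ (_ , c′≡β)) = ⊥-elim (c≢ (trans c≡β (sym c′≡β)))
      v≡u′ : v ≡ u′
      v≡u′ = proj₂ proper u v u′ uv (trans (K-sym u u′) u′u)
        (trans (previous-colour c (colour-alternates i′)) (trans (sym cu′u) (proj₁ proper u′ u u′u)))

    linked⇒OnWalk : ∀ {q} → Linked (bicoloured K col α β) m p q → OnWalk q
    linked⇒OnWalk l = Linked-closed (bicoloured K col α β) OnWalk OnWalk-closed l (0 , refl)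

    MissesαOrβ : V → Set
    MissesαOrβ q = Misses K col q α ⊎ Misses K col q β

    walk-ends-at : ∀ q i → walk i ≡ just q → q ≢ p → MissesαOrβ q → walk (suc i) ≡ nothing
    walk-ends-at q zero e q≢p _ = ⊥-elim (q≢p (sym (just-injective e)))
    walk-ends-at q (suc i) e q≢p mq with walk-back i q e
    ... | u , wi , uq , cuq = trans (walk-step (suc i) q e) (next-end _ q misses-next)
      where
      cqu : col q u ≡ colour i
      cqu = trans (proj₁ proper q u (trans (K-sym q u) uq)) cuq
      qu : Adj K q u
      qu = trans (K-sym q u) uq
      misses-next′ : MissesαOrβ q → (colour i ≡ β × colour (suc i) ≡ α) ⊎ (colour i ≡ α × colour (suc i) ≡ β) →
        Misses K col q (colour (suc i))
      misses-next′ (inj₁ ms) (inj₁ (_ , c≡α)) = subst (Misses K col q) (sym c≡α) ms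
      misses-next′ (inj₁ ms) (inj₂ (c≡α , _)) = ⊥-elim (ms u qu (trans cqu c≡α))
      misses-next′ (inj₂ ms) (inj₁ (c≡β , _)) = ⊥-elim (ms u qu (trans cqu c≡β))
      misses-next′ (inj₂ ms) (inj₂ (_ , c≡β)) = subst (Misses K col q) (sym c≡β) ms
      misses-next : Misses K col q (colour (suc i))
      misses-next = misses-next′ mq (colour-alternates i)

    at-most-one-far-end : ∀ q s → q ≢ p → s ≢ p → q ≢ s → MissesαOrβ q → MissesαOrβ s →
      Linked (bicoloured K col α β) m p q → Linked (bicoloured K col α β) m p s → ⊥
    at-most-one-far-end q s q≢p s≢p q≢s mq ms lq ls with linked⇒OnWalk lq | linked⇒OnWalk ls
    ... | i , wi | j , wj with walk-ends-at q i wi q≢p mq | walk-ends-at s j wj s≢p ms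
    ...   | ei | ej with <-cmp i j
    ...     | tri< i<j _ _ with trans (sym wj) (walk-stopped (suc i) j i<j ei)
    ...       | ()
    at-most-one-far-end q s q≢p s≢p q≢s mq ms lq ls | i , wi | j , wj | ei | ej | tri≈ _ refl _ =
      q≢s (just-injective (trans (sym wi) wj))
    at-most-one-far-end q s q≢p s≢p q≢s mq ms lq ls | i , wi | j , wj | ei | ej | tri> _ _ j<i
      with trans (sym wi) (walk-stopped (suc j) i j<i ej)
    ... | ()

  module ExtendByEdge (K : Graph V) (K⊆H : Subgraph K) (K-sym : Symmetric K) (pc : ProperColouring K)
    (x y₀ : V) (Hxy₀ : Adj H x y₀) (Kxy₀ : K x y₀ ≡ false) where

    open ProperColouring pc

    mc : V → ℕ
    mc v = proj₁ (missing-colour K K⊆H col v)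

    mc<k : ∀ v → mc v < k
    mc<k v = proj₁ (proj₂ (missing-colour K K⊆H col v))

    mc-missing : ∀ v → Misses K col v (mc v)
    mc-missing v = proj₂ (proj₂ (missing-colour K K⊆H col v))

    K′ : Graph V
    K′ = addEdge K x y₀

    rotate : (pc′ : ProperColouring K) (T : ℕ) (y : ℕ → V) → Fan K (ProperColouring.col pc′) x y₀ mc T y →
      (∀ i → i < T → Misses K (ProperColouring.col pc′) (y i) (mc (y i))) →
      ∀ γ → γ < k → Misses K (ProperColouring.col pc′) x γ → Misses K (ProperColouring.col pc′) (y T) γ →
      ProperColouring K′
    rotate pc′ T y fan ms γ γ<k γ-x γ-end =
      FanRotation.rotated K K⊆H K-sym pc′ x y₀ Hxy₀ mc mc<k T y fan ms γ γ<k γ-x γ-end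

    α : ℕ
    α = mc x

    module _ (T : ℕ) (y : ℕ → V) (fan : Fan K col x y₀ mc T y) where

      open Fan fan

      x≢y : ∀ i → i ≤ T → x ≢ y i
      x≢y zero _ e = subgraph-irrefl H (λ _ _ h → h) x (subst (Adj H x) (sym (trans e start)) Hxy₀)
      x≢y (suc i) i<T e = subgraph-irrefl K K⊆H x (subst (Adj K x) (sym e) (proj₁ (chain i i<T)))

      close-at-missing : Misses K col x (mc (y T)) → ProperColouring K′
      close-at-missing ms = rotate pc T y fan (λ i _ → mc-missing (y i)) (mc (y T)) (mc<k (y T)) ms (mc-missing (y T))

      -- The colour β missing at the last fan vertex s is already used at x, on the fan edge
      -- x (y (j+1)); so q = y j misses β too.  Swapping α/β on the component of q, or else on
      -- the component of s, frees α at the end of a (possibly shortened) fan.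
      close-by-kempe-chain : ∀ j → j < T → Adj K x (y (suc j)) → col x (y (suc j)) ≡ mc (y T) → ProperColouring K′
      close-by-kempe-chain j j<T x-yj+1 col≡β = by-component-of-q (Z-q x) refl
        where
        β : ℕ
        q s : V
        β = mc (y T)
        q = y j
        s = y T
        q-misses-β : Misses K col q β
        q-misses-β = subst (Misses K col q) (trans (sym (proj₂ (chain j j<T))) col≡β) (mc-missing q)
        s-misses-β : Misses K col s β
        s-misses-β = mc-missing s
        α≢β : α ≢ β
        α≢β e = mc-missing x (y (suc j)) x-yj+1 (trans col≡β (sym e))
        F : Graph V
        F = bicoloured K col α β
        F-sym : Symmetric F
        F-sym = bicoloured-sym K col α β K-sym (proj₁ proper)
        component : V → V → Bool
        component z v = does (linked? F m ≤-refl z v)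
        component-closed : ∀ z u v → component z u ≡ true → Adj K u v → (col u v ≡ α) ⊎ (col u v ≡ β) → component z v ≡ true
        component-closed z u v zu uv c = dec-true (linked? F m ≤-refl z v)
          (Linked-trans F (does-true⇒ (linked? F m ≤-refl z u) zu) (linked-edge (bicoloured-intro K col α β u v uv c)))
        Z-q Z-s : V → Bool
        Z-q = component q
        Z-s = component s
        fan-colour≢α : ∀ i → i < T → mc (y i) ≢ α
        fan-colour≢α i i<T e = mc-missing x (y (suc i)) (proj₁ (chain i i<T)) (trans (proj₂ (chain i i<T)) e)
        fan-colour≢β : ∀ i → i < T → i ≢ j → mc (y i) ≢ β
        fan-colour≢β i i<T i≢j e = i≢j (suc-injective (injective (suc i) (suc j) i<T j<T
          (proj₂ proper x _ _ (proj₁ (chain i i<T)) x-yj+1 (trans (proj₂ (chain i i<T)) (trans e (sym col≡β))))))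
        q≢x : q ≢ x
        q≢x e = x≢y j (<⇒≤ j<T) (sym e)
        s≢x : s ≢ x
        s≢x e = x≢y T ≤-refl (sym e)
        q≢s : q ≢ s
        q≢s e = <-irrefl (injective j T (<⇒≤ j<T) ≤-refl e) j<T
        module Path = AlternatingPath K K-sym col proper α β α≢β x (mc-missing x)
        by-component-of-q : (b : Bool) → Z-q x ≡ b → ProperColouring K′
        by-component-of-q false x∉Zq =
          rotate Swap.swapped j y shortened-fan
            (λ i i<j → Swap.misses-other (y i) (mc (y i)) (fan-colour≢α i (<-trans i<j j<T))
                         (fan-colour≢β i (<-trans i<j j<T) (λ e → <-irrefl e i<j)) (mc-missing (y i)))
            α (mc<k x) (Swap.misses-outside x α x∉Zq (mc-missing x))
            (Swap.misses-inside q (dec-true (linked? F m ≤-refl q q) linked-refl) q-misses-β)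
          where
          module Swap = KempeSwap K K-sym pc α β (mc<k x) (mc<k (y T)) Z-q (component-closed q)
          shortened-fan : Fan K Swap.col′ x y₀ mc j y
          shortened-fan = record
            { start = start
            ; injective = λ i i′ i≤j i′≤j → injective i i′ (≤-trans i≤j (<⇒≤ j<T)) (≤-trans i′≤j (<⇒≤ j<T))
            ; chain = λ i i<j → proj₁ (chain i (<-trans i<j j<T)) ,
                         trans (Swap.col′-outside x (y (suc i)) x∉Zq) (proj₂ (chain i (<-trans i<j j<T)))
            }
        by-component-of-q true x∈Zq = by-component-of-s (Z-s x) (Z-s q) refl refl
          where
          x~q : Linked F m x q
          x~q = Linked-sym F F-sym (does-true⇒ (linked? F m ≤-refl q x) x∈Zq)
          by-component-of-s : (b c : Bool) → Z-s x ≡ b → Z-s q ≡ c → ProperColouring K′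
          by-component-of-s true _ x∈Zs _ =
            ⊥-elim (Path.at-most-one-far-end q s q≢x s≢x q≢s (inj₂ q-misses-β) (inj₂ s-misses-β) x~q
                      (Linked-sym F F-sym (does-true⇒ (linked? F m ≤-refl s x) x∈Zs)))
          by-component-of-s false true _ q∈Zs =
            ⊥-elim (Path.at-most-one-far-end q s q≢x s≢x q≢s (inj₂ q-misses-β) (inj₂ s-misses-β) x~q
                      (Linked-trans F x~q (Linked-sym F F-sym (does-true⇒ (linked? F m ≤-refl s q) q∈Zs))))
          by-component-of-s false false x∉Zs q∉Zs =
            rotate Swap.swapped T y same-fan still-missing
              α (mc<k x) (Swap.misses-outside x α x∉Zs (mc-missing x))
              (Swap.misses-inside s (dec-true (linked? F m ≤-refl s s) linked-refl) s-misses-β)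
            where
            module Swap = KempeSwap K K-sym pc α β (mc<k x) (mc<k (y T)) Z-s (component-closed s)
            same-fan : Fan K Swap.col′ x y₀ mc T y
            same-fan = record
              { start = start
              ; injective = injective
              ; chain = λ i i<T → proj₁ (chain i i<T) , trans (Swap.col′-outside x (y (suc i)) x∉Zs) (proj₂ (chain i i<T))
              }
            still-missing : ∀ i → i < T → Misses K Swap.col′ (y i) (mc (y i))
            still-missing i i<T with i ≟ℕ j
            ... | yes refl = Swap.misses-outside q (mc q) q∉Zs (mc-missing q)
            ... | no i≢j = Swap.misses-other (y i) (mc (y i)) (fan-colour≢α i i<T) (fan-colour≢β i i<T i≢j) (mc-missing (y i))

    snoc : (ℕ → V) → ℕ → V → ℕ → V
    snoc y T w i = if does (i ≟ℕ suc T) then w else y i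

    snoc-new : ∀ y T w → snoc y T w (suc T) ≡ w
    snoc-new y T w rewrite dec-true (suc T ≟ℕ suc T) refl = refl

    snoc-old : ∀ y T w i → i ≤ T → snoc y T w i ≡ y i
    snoc-old y T w i i≤T rewrite dec-false (i ≟ℕ suc T) (λ { refl → <-irrefl refl i≤T }) = refl

    grow-fan : ∀ T y w → Fan K col x y₀ mc T y → Adj K x w → col x w ≡ mc (y T) → ¬ (∃ λ i → i ≤ T × y i ≡ w) →
      Fan K col x y₀ mc (suc T) (snoc y T w)
    grow-fan T y w fan xw col≡ w∉ =
      record { start = trans (snoc-old y T w 0 z≤n) (Fan.start fan) ; injective = injective′ ; chain = chain′ }
      where
      y′ : ℕ → V
      y′ = snoc y T w
      last-or-old : ∀ i → i ≤ suc T → (i ≡ suc T) ⊎ (i ≤ T)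
      last-or-old i i≤ with m≤n⇒m<n∨m≡n i≤
      ... | inj₁ i<1+T = inj₂ (≤-pred i<1+T)
      ... | inj₂ i≡ = inj₁ i≡
      injective′ : ∀ i j → i ≤ suc T → j ≤ suc T → y′ i ≡ y′ j → i ≡ j
      injective′ i j i≤ j≤ e with last-or-old i i≤ | last-or-old j j≤
      ... | inj₁ a | inj₁ b = trans a (sym b)
      ... | inj₁ refl | inj₂ b = ⊥-elim (w∉ (j , b , sym (trans (sym (snoc-new y T w)) (trans e (snoc-old y T w j b)))))
      ... | inj₂ a | inj₁ refl = ⊥-elim (w∉ (i , a , trans (sym (snoc-old y T w i a)) (trans e (snoc-new y T w))))
      ... | inj₂ a | inj₂ b = Fan.injective fan i j a b (trans (sym (snoc-old y T w i a)) (trans e (snoc-old y T w j b)))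
      chain′ : ∀ i → i < suc T → Adj K x (y′ (suc i)) × col x (y′ (suc i)) ≡ mc (y′ i)
      chain′ i i< with last-or-old (suc i) i<
      ... | inj₁ refl rewrite snoc-new y T w | snoc-old y T w T ≤-refl = xw , col≡
      ... | inj₂ i<T rewrite snoc-old y T w (suc i) i<T | snoc-old y T w i (<⇒≤ i<T) = Fan.chain fan i i<T

    fan-size≤ : ∀ T y → Fan K col x y₀ mc T y → suc T ≤ m
    fan-size≤ T y fan = injective⇒≤ {f = λ (i : Fin (suc T)) → y (toℕ i)}
      (λ {i} {j} e → toℕ-injective (Fan.injective fan (toℕ i) (toℕ j) (≤-pred (toℕ<n i)) (≤-pred (toℕ<n j)) e))

    -- A fan has at most m vertices, so m - T extension steps suffice.
    close-fan : (fuel T : ℕ) (y : ℕ → V) → m ≤ T + fuel → Fan K col x y₀ mc T y → ProperColouring K′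
    close-fan zero T y m≤T fan =
      ⊥-elim (<-irrefl refl (≤-trans (fan-size≤ T y fan) (≤-trans m≤T (≤-reflexive (+-identityʳ T)))))
    close-fan (suc fuel) T y m≤ fan with inPalette? K col x (mc (y T))
    ... | no ¬in = close-at-missing T y fan (λ u xu e → ¬in (u , xu , e))
    ... | yes (w , xw , col≡) with anyUpTo? (λ i → y i ≟ w) (suc T)
    ...   | yes (zero , _ , e) = ⊥-elim (false≢true (trans (sym Kxy₀) (subst (Adj K x) (trans (sym e) (Fan.start fan)) xw)))
    ...   | yes (suc j , j<T , refl) = close-by-kempe-chain T y fan j (≤-pred j<T) xw col≡
    ...   | no w∉ = close-fan fuel (suc T) (snoc y T w) (≤-trans m≤ (≤-reflexive (+-suc T fuel)))
                      (grow-fan T y w fan xw col≡ λ (i , i≤T , e) → w∉ (i , s≤s i≤T , e))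

    extended : ProperColouring K′
    extended = close-fan m 0 (λ _ → y₀) ≤-refl
      (record { start = refl ; injective = λ { zero zero _ _ _ → refl } ; chain = λ _ () })

  restrict : ∀ K K′ → (∀ u v → Adj K′ u v → Adj K u v) → ProperColouring K → ProperColouring K′
  restrict K K′ K′⊆K pc = record
    { col = col
    ; proper = (λ u v e → proj₁ proper u v (K′⊆K u v e)) , (λ u v w e e′ → proj₂ proper u v w (K′⊆K u v e) (K′⊆K u w e′))
    ; col<k = λ u v e → col<k u v (K′⊆K u v e)
    }
    where open ProperColouring pc

  edgesIn : List (V × V) → Graph V
  edgesIn [] u v = false
  edgesIn ((a , b) ∷ L) = if H a b then addEdge (edgesIn L) a b else edgesIn L

  edgesIn-subgraph : ∀ L → Subgraph (edgesIn L)
  edgesIn-subgraph ((a , b) ∷ L) u v e with H a b in Hab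
  ... | true = addEdge-subgraph (edgesIn L) a b (edgesIn-subgraph L) Hab u v e
  ... | false = edgesIn-subgraph L u v e

  edgesIn-sym : ∀ L → Symmetric (edgesIn L)
  edgesIn-sym [] u v = refl
  edgesIn-sym ((a , b) ∷ L) u v with H a b
  ... | true = addEdge-sym (edgesIn L) a b (edgesIn-sym L) u v
  ... | false = edgesIn-sym L u v

  edgesIn-colouring : ∀ L → ProperColouring (edgesIn L)
  edgesIn-colouring [] = record { col = λ _ _ → 0 ; proper = (λ _ _ ()) , (λ _ _ _ ()) ; col<k = λ _ _ () }
  edgesIn-colouring ((a , b) ∷ L) with H a b in Hab
  ... | false = edgesIn-colouring L
  ... | true with edgesIn L a b in Lab
  ...   | true = restrict (edgesIn L) (addEdge (edgesIn L) a b) already-there (edgesIn-colouring L)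
    where
    already-there : ∀ u v → Adj (addEdge (edgesIn L) a b) u v → Adj (edgesIn L) u v
    already-there u v e with addEdge-inv (edgesIn L) a b u v e
    ... | inj₁ uv = uv
    ... | inj₂ (inj₁ (refl , refl)) = Lab
    ... | inj₂ (inj₂ (refl , refl)) = trans (edgesIn-sym L u v) Lab
  ...   | false = ExtendByEdge.extended (edgesIn L) (edgesIn-subgraph L) (edgesIn-sym L) (edgesIn-colouring L) a b Hab Lab

  edgesIn-complete : ∀ L u v → Adj H u v → (u , v) ∈ L → Adj (edgesIn L) u v
  edgesIn-complete ((a , b) ∷ L) u v Huv (here refl) rewrite Huv = addEdge-new (edgesIn L) u v
  edgesIn-complete ((a , b) ∷ L) u v Huv (there uv∈) with H a b
  ... | true = addEdge-⊇ (edgesIn L) a b u v (edgesIn-complete L u v Huv uv∈)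
  ... | false = edgesIn-complete L u v Huv uv∈

  vizing : ProperColouring H
  vizing = restrict (edgesIn allPairs) H
    (λ u v e → edgesIn-complete allPairs u v e (∈-cartesianProductWith⁺ _,_ (∈-allFin u) (∈-allFin v)))
    (edgesIn-colouring allPairs)
    where
    allPairs : List (V × V)
    allPairs = cartesianProduct (allFin m) (allFin m)

-- Perfect matchings

module _ {n : ℕ} {G M : Graph (Fin n)} (M-perfect : PerfectMatching G M) where

  matching-partner-unique : ∀ a v w → Adj M a v → Adj M a w → v ≡ w
  matching-partner-unique a v w = deg≡1⇒neighbour-unique M a v w (proj₂ M-perfect a)

  matching-partner : ∀ a → ∃ λ v → Adj M a v
  matching-partner a = deg-pos⇒neighbour M a (≤-reflexive (sym (proj₂ M-perfect a)))

  deg-∖-perfectMatching : ∀ a → deg (G ∖ M) a + 1 ≡ deg G a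
  deg-∖-perfectMatching a =
    trans (cong (deg (G ∖ M) a +_) (sym (proj₂ M-perfect a))) (deg-∖-+ G M (proj₂ (proj₁ M-perfect)) a)

  module _ {X : Graph (Fin n)} (X⊆M : EdgeSubset X M) where

    Covered : Fin n → Set
    Covered a = ∃ λ v → Adj X a v

    covered? : ∀ a → Dec (Covered a)
    covered? a = any? (λ v → X a v ≟ᴮ true)

    X⊆G : ∀ a v → Adj X a v → Adj G a v
    X⊆G a v e = proj₂ (proj₁ M-perfect) a v (proj₂ X⊆M a v e)

    deg-covered : ∀ a → Covered a → deg X a ≡ 1
    deg-covered a (v , av) = ≤-antisym
      (≤-trans (count-mono (X a) (M a) (allFin n) (proj₂ X⊆M a)) (≤-reflexive (proj₂ M-perfect a)))
      (≤-trans (s≤s z≤n) (count-without _≟_ (X a) v (allFin n) (∈-allFin v) av))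

    deg-uncovered : ∀ a → ¬ Covered a → deg X a ≡ 0
    deg-uncovered a uncovered = count-false (X a) (allFin n) X-false
      where
      X-false : ∀ v → X a v ≡ false
      X-false v with X a v in e
      ... | true = ⊥-elim (uncovered (v , e))
      ... | false = refl

    deg-∖-covered : ∀ a → Covered a → deg (G ∖ X) a + 1 ≡ deg G a
    deg-∖-covered a cov = trans (cong (deg (G ∖ X) a +_) (sym (deg-covered a cov))) (deg-∖-+ G X X⊆G a)

    deg-∖-uncovered : ∀ a → ¬ Covered a → deg (G ∖ X) a ≡ deg G a
    deg-∖-uncovered a unc =
      trans (sym (+-identityʳ _)) (trans (cong (deg (G ∖ X) a +_) (sym (deg-uncovered a unc))) (deg-∖-+ G X X⊆G a))

    deg-covered<deg-uncovered : ∀ {r} → IsRegularOfDegree G r → ∀ a a′ → Covered a → ¬ Covered a′ →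
      deg (G ∖ X) a < deg (G ∖ X) a′
    deg-covered<deg-uncovered G-regular a a′ cov unc = begin-strict
      deg (G ∖ X) a       <⟨ m<m+n _ (s≤s z≤n) ⟩
      deg (G ∖ X) a + 1   ≡⟨ trans (deg-∖-covered a cov) (G-regular a) ⟩
      _                   ≡⟨ trans (sym (G-regular a′)) (sym (deg-∖-uncovered a′ unc)) ⟩
      deg (G ∖ X) a′      ∎
      where open ≤-Reasoning

    M∖X-end-uncovered : ∀ a v → Adj M a v → X a v ≡ false → ¬ Covered a
    M∖X-end-uncovered a v Mav ¬Xav (w , Xaw) =
      false≢true (trans (sym ¬Xav) (subst (Adj X a) (matching-partner-unique a w v (proj₂ X⊆M a w Xaw) Mav) Xaw))

-- If r ≤ 1 every edge of G is a matching edge, so the two ends of an X-edge form a whole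
-- component of G; by connectivity that is all of G, leaving no room for an M-edge outside X.
regular-degree≥2 : ∀ {n r} {G M X : Graph (Fin n)} → Connected G → IsRegularOfDegree G r →
  PerfectMatching G M → NonemptyProperSubset X M → 2 ≤ r
regular-degree≥2 {n} {r} {G} {M} {X} G-connected G-regular M-perfect ((X-sym , X⊆M) , (u , v , uv) , (a , b , ab , ¬Xab))
  with 2 ≤? r
... | yes 2≤r = 2≤r
... | no 2≰r = ⊥-elim (a∉X (reach⇒end (proj₂ G-connected u a) (inj₁ refl)))
  where
  edge⇒matching : ∀ w z → Adj G w z → Adj M w z
  edge⇒matching w z wz with matching-partner M-perfect w
  ... | p , wp with z ≟ p
  ...   | yes refl = wp
  ...   | no z≢p = ⊥-elim (2≰r (≤-trans (two-neighbours⇒2≤deg G w z p wz (proj₂ (proj₁ M-perfect) w p wp) z≢p)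
                                         (≤-reflexive (G-regular w))))
  End : Fin n → Set
  End w = (w ≡ u) ⊎ (w ≡ v)
  Muv : Adj M u v
  Muv = X⊆M u v uv
  Mvu : Adj M v u
  Mvu = trans (proj₁ (proj₁ M-perfect) v u) Muv
  edge⇒end : ∀ w z → End w → Adj G w z → End z
  edge⇒end w z (inj₁ refl) wz = inj₂ (matching-partner-unique M-perfect u z v (edge⇒matching u z wz) Muv)
  edge⇒end w z (inj₂ refl) wz = inj₁ (matching-partner-unique M-perfect v z u (edge⇒matching v z wz) Mvu)
  reach⇒end : ∀ {w z} → Reach G w z → End w → End z
  reach⇒end here e = e
  reach⇒end (step wz rest) e = reach⇒end rest (edge⇒end _ _ e wz)
  a∉X : ¬ End a
  a∉X (inj₁ refl) = false≢true (trans (sym ¬Xab) (subst (Adj X u) (matching-partner-unique M-perfect u v b Muv ab) uv))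
  a∉X (inj₂ refl) = false≢true (trans (sym ¬Xab)
    (subst (Adj X v) (matching-partner-unique M-perfect v u b Mvu ab) (trans (X-sym v u) uv)))

-- A colouring with two palettes

-- In the copy G × {b}, the colour-0 class of G′ − M takes the colour μ b that b misses in the
-- (d+1)-colouring of H, colour i > 0 becomes d + 1 + i, and the M-edges outside X get d + 1.
-- Every vertex then sees all of 0, …, d + c except that the ends of X-edges miss d + 1.
module TwoPaletteColouring {n m : ℕ} (G′ M X : Graph (Fin n)) (H : Graph (Fin m))
  (G′-simple : IsSimple G′) (M-perfect : PerfectMatching G′ M) (X⊆M : EdgeSubset X M)
  (c : ℕ) (0<c : 0 < c) (Gm-regular : IsRegularOfDegree (G′ ∖ M) c)
  (g : Fin n → Fin n → ℕ) (g-proper : IsProperEdgeColoring (G′ ∖ M) g) (g<c : ∀ u v → Adj (G′ ∖ M) u v → g u v < c)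
  (H-simple : IsSimple H) (d : ℕ) (H-regular : IsRegularOfDegree H d)
  (h : Fin m → Fin m → ℕ) (h-proper : IsProperEdgeColoring H h) (h≤d : ∀ u v → Adj H u v → h u v < suc d) where

  G Gm : Graph (Fin n)
  G = G′ ∖ X
  Gm = G′ ∖ M

  P : Graph (Fin n × Fin m)
  P = G □ H

  private
    M⊆G′ : ∀ a v → Adj M a v → Adj G′ a v
    M⊆G′ = proj₂ (proj₁ M-perfect)
    M-unique : ∀ a v w → Adj M a v → Adj M a w → v ≡ w
    M-unique = matching-partner-unique M-perfect
    Covered′ : Fin n → Set
    Covered′ = Covered M-perfect X⊆M
    covered?′ : ∀ a → Dec (Covered′ a)
    covered?′ = covered? M-perfect X⊆M

  ∧-true⇒ : ∀ a b → a ∧ b ≡ true → a ≡ true × b ≡ true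
  ∧-true⇒ true true _ = refl , refl

  G⊆G′ : ∀ a v → Adj G a v → Adj G′ a v
  G⊆G′ a v e = proj₁ (∧-true⇒ _ _ e)

  G-irrefl : ∀ a → G a a ≡ false
  G-irrefl a rewrite proj₂ G′-simple a = refl

  G-adj⇒≢ : ∀ a v → Adj G a v → a ≢ v
  G-adj⇒≢ a v e refl = false≢true (trans (sym (G-irrefl a)) e)

  Gm⊆G : ∀ a v → Adj Gm a v → Adj G a v
  Gm⊆G a v e with ∧-true⇒ (G′ a v) (not (M a v)) e | X a v in Xav
  ... | G′av , _ | false rewrite G′av = refl
  ... | _ , ¬Mav | true rewrite proj₂ X⊆M a v Xav with ¬Mav
  ...   | ()

  Gm-sym : ∀ a v → Gm a v ≡ Gm v a
  Gm-sym a v rewrite proj₁ G′-simple a v | proj₁ (proj₁ M-perfect) a v = refl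

  G∖Gm⊆M : ∀ a v → Adj G a v → Gm a v ≡ false → Adj M a v
  G∖Gm⊆M a v e ¬Gm with M a v
  ... | true = refl
  ... | false rewrite G⊆G′ a v e with ¬Gm
  ...   | ()

  covered⇒no-M-edge : ∀ a → Covered′ a → ∀ v → Adj G a v → M a v ≡ false
  covered⇒no-M-edge a (w , aw) v e with M a v in Mav
  ... | false = refl
  ... | true = ⊥-elim (false≢true (trans (sym (cong not (subst (Adj X a) (M-unique a w v (proj₂ X⊆M a w aw) Mav) aw)))
                                      (proj₂ (∧-true⇒ _ _ e))))

  uncovered⇒M-edge : ∀ a → ¬ Covered′ a → ∃ λ v → Adj M a v × Adj G a v
  uncovered⇒M-edge a uncovered with matching-partner M-perfect a
  ... | v , Mav with X a v in Xav
  ...   | true = ⊥-elim (uncovered (v , Xav))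
  ...   | false = v , Mav , Gav
    where
    Gav : Adj G a v
    Gav rewrite M⊆G′ a v Mav | Xav = refl

  μ : Fin m → ℕ
  μ b = proj₁ (deg<⇒misses-colour H h (suc d) b (s≤s (≤-reflexive (H-regular b))))

  μ≤d : ∀ b → μ b < suc d
  μ≤d b = proj₁ (proj₂ (deg<⇒misses-colour H h (suc d) b (s≤s (≤-reflexive (H-regular b)))))

  μ-missing : ∀ b → Misses H h b (μ b)
  μ-missing b = proj₂ (proj₂ (deg<⇒misses-colour H h (suc d) b (s≤s (≤-reflexive (H-regular b)))))

  h-inPalette : ∀ b j → j < suc d → j ≢ μ b → InPalette H h b j
  h-inPalette b j j≤d j≢μ =
    1+deg≡⇒inPalette-except H h h-proper (suc d) h≤d b (cong suc (H-regular b)) (μ b) (μ≤d b) (μ-missing b) j j≤d j≢μ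

  g-inPalette : ∀ a j → j < c → InPalette Gm g a j
  g-inPalette a = deg≡⇒inPalette Gm g g-proper c g<c a (Gm-regular a)

  shift : ℕ → ℕ → ℕ
  shift μb zero = μb
  shift μb (suc i) = suc d + suc i

  colourG : Fin m → Fin n → Fin n → ℕ
  colourG b a v = if Gm a v then shift (μ b) (g a v) else suc d

  colour : Fin n × Fin m → Fin n × Fin m → ℕ
  colour (a , b) (v , e) = if does (a ≟ v) then h b e else colourG b a v

  P-inv : ∀ a b v e → Adj P (a , b) (v , e) → (Adj G a v × b ≡ e) ⊎ (a ≡ v × Adj H b e)
  P-inv a b v e adj with G a v | b ≟ e | a ≟ v | H b e in Hbe
  ... | true | yes b≡e | _ | _ = inj₁ (refl , b≡e)
  ... | _ | _ | yes a≡v | true = inj₂ (a≡v , refl)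
  ... | false | _ | no _ | _ = ⊥-elim (false≢true adj)
  ... | false | _ | yes _ | false = ⊥-elim (false≢true adj)
  ... | true | no _ | no _ | _ = ⊥-elim (false≢true adj)
  ... | true | no _ | yes _ | false = ⊥-elim (false≢true adj)

  P-G : ∀ a b v → Adj G a v → Adj P (a , b) (v , b)
  P-G a b v e rewrite e | isYes≗does (b ≟ b) | dec-true (b ≟ b) refl = refl

  P-H : ∀ a b e → Adj H b e → Adj P (a , b) (a , e)
  P-H a b e Hbe rewrite Hbe | isYes≗does (a ≟ a) | dec-true (a ≟ a) refl = ∨-zeroʳ _

  colour-H : ∀ a b e → colour (a , b) (a , e) ≡ h b e
  colour-H a b e rewrite dec-true (a ≟ a) refl = refl

  colour-G : ∀ a b v e → a ≢ v → colour (a , b) (v , e) ≡ colourG b a v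
  colour-G a b v e a≢v rewrite dec-false (a ≟ v) a≢v = refl

  colourG-sym : ∀ b a v → colourG b a v ≡ colourG b v a
  colourG-sym b a v with Gm a v in Gmav
  ... | true rewrite trans (sym (Gm-sym a v)) Gmav | proj₁ g-proper a v Gmav = refl
  ... | false rewrite trans (sym (Gm-sym a v)) Gmav = refl

  colourG-range : ∀ b a v → (colourG b a v ≡ μ b) ⊎ (suc d ≤ colourG b a v)
  colourG-range b a v with Gm a v | g a v
  ... | true | zero = inj₁ refl
  ... | true | suc i = inj₂ (m≤m+n (suc d) (suc i))
  ... | false | _ = inj₂ ≤-refl

  1+d+1+i≢1+d : ∀ i → suc d + suc i ≢ suc d
  1+d+1+i≢1+d i e = <-irrefl (sym e) (m<m+n (suc d) (s≤s z≤n))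

  colourG-injective : ∀ b a v w → Adj G a v → Adj G a w → colourG b a v ≡ colourG b a w → v ≡ w
  colourG-injective b a v w av aw e with Gm a v in Gmav | Gm a w in Gmaw | g a v in gav | g a w in gaw
  ... | true | true | zero | zero = proj₂ g-proper a v w Gmav Gmaw (trans gav (sym gaw))
  ... | true | true | zero | suc j = ⊥-elim (<-irrefl refl (≤-trans (μ≤d b) (≤-trans (m≤m+n (suc d) (suc j)) (≤-reflexive (sym e)))))
  ... | true | true | suc i | zero = ⊥-elim (<-irrefl refl (≤-trans (μ≤d b) (≤-trans (m≤m+n (suc d) (suc i)) (≤-reflexive e))))
  ... | true | true | suc i | suc j = proj₂ g-proper a v w Gmav Gmaw (trans gav (trans (cong suc i≡j) (sym gaw)))
    where
    i≡j : i ≡ j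
    i≡j = suc-injective (+-cancelˡ-≡ (suc d) (suc i) (suc j) e)
  ... | true | false | zero | _ = ⊥-elim (<-irrefl e (μ≤d b))
  ... | true | false | suc i | _ = ⊥-elim (1+d+1+i≢1+d i e)
  ... | false | true | _ | zero = ⊥-elim (<-irrefl (sym e) (μ≤d b))
  ... | false | true | _ | suc j = ⊥-elim (1+d+1+i≢1+d j (sym e))
  ... | false | false | _ | _ = M-unique a v w (G∖Gm⊆M a v av Gmav) (G∖Gm⊆M a w aw Gmaw)

  H-colour≢G-colour : ∀ a b v e → Adj G a v → Adj H b e → h b e ≢ colourG b a v
  H-colour≢G-colour a b v e av Hbe eq with colourG-range b a v
  ... | inj₁ ≡μ = μ-missing b e Hbe (trans eq ≡μ)
  ... | inj₂ 1+d≤ = <-irrefl refl (≤-trans (s≤s 1+d≤) (≤-trans (s≤s (≤-reflexive (sym eq))) (h≤d b e Hbe)))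

  colour-sym : ∀ w z → Adj P w z → colour w z ≡ colour z w
  colour-sym (a , b) (v , e) adj with P-inv a b v e adj
  ... | inj₁ (av , refl) =
    trans (colour-G a b v b (G-adj⇒≢ a v av))
      (trans (colourG-sym b a v) (sym (colour-G v b a b (λ v≡a → G-adj⇒≢ a v av (sym v≡a)))))
  ... | inj₂ (refl , Hbe) = trans (colour-H a b e) (trans (proj₁ h-proper b e Hbe) (sym (colour-H a e b)))

  colour-injective : ∀ w z₁ z₂ → Adj P w z₁ → Adj P w z₂ → colour w z₁ ≡ colour w z₂ → z₁ ≡ z₂
  colour-injective (a , b) (v₁ , e₁) (v₂ , e₂) adj₁ adj₂ eq with P-inv a b v₁ e₁ adj₁ | P-inv a b v₂ e₂ adj₂
  ... | inj₁ (av₁ , refl) | inj₁ (av₂ , refl) = cong (_, b) (colourG-injective b a v₁ v₂ av₁ av₂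
          (trans (sym (colour-G a b v₁ b (G-adj⇒≢ a v₁ av₁))) (trans eq (colour-G a b v₂ b (G-adj⇒≢ a v₂ av₂)))))
  ... | inj₂ (refl , Hbe₁) | inj₂ (refl , Hbe₂) = cong (a ,_) (proj₂ h-proper b e₁ e₂ Hbe₁ Hbe₂
          (trans (sym (colour-H a b e₁)) (trans eq (colour-H a b e₂))))
  ... | inj₁ (av₁ , refl) | inj₂ (refl , Hbe₂) = ⊥-elim (H-colour≢G-colour a b v₁ e₂ av₁ Hbe₂
          (trans (sym (colour-H a b e₂)) (trans (sym eq) (colour-G a b v₁ b (G-adj⇒≢ a v₁ av₁)))))
  ... | inj₂ (refl , Hbe₁) | inj₁ (av₂ , refl) = ⊥-elim (H-colour≢G-colour a b v₂ e₁ av₂ Hbe₁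
          (trans (sym (colour-H a b e₁)) (trans eq (colour-G a b v₂ b (G-adj⇒≢ a v₂ av₂)))))

  colour-proper : IsProperEdgeColoring P colour
  colour-proper = colour-sym , colour-injective

  colourG-Gm : ∀ b a v → Adj Gm a v → colourG b a v ≡ shift (μ b) (g a v)
  colourG-Gm b a v Gmav rewrite Gmav = refl

  colourG-M : ∀ b a v → Adj M a v → colourG b a v ≡ suc d
  colourG-M b a v Mav rewrite Mav | ∧-zeroʳ (G′ a v) = refl

  colourG<1+d+c : ∀ b a v → colourG b a v < suc d + c
  colourG<1+d+c b a v with Gm a v in Gmav | g a v in gav
  ... | true | zero = ≤-trans (μ≤d b) (m≤m+n (suc d) c)
  ... | true | suc i = +-monoʳ-< (suc d) (subst (_< c) gav (g<c a v Gmav))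
  ... | false | _ = m<m+n (suc d) 0<c

  colourG≡1+d⇒M : ∀ b a v → Adj G a v → colourG b a v ≡ suc d → Adj M a v
  colourG≡1+d⇒M b a v av e with Gm a v in Gmav | g a v
  ... | true | zero = ⊥-elim (<-irrefl e (μ≤d b))
  ... | true | suc i = ⊥-elim (1+d+1+i≢1+d i e)
  ... | false | _ = G∖Gm⊆M a v av Gmav

  -- the palette of (a , b), whatever b is
  Palette : Fin n → ℕ → Set
  Palette a j = j < suc d + c × (Covered′ a → j ≢ suc d)

  palette-⊆ : ∀ a b j → InPalette P colour (a , b) j → Palette a j
  palette-⊆ a b j ((v , e) , adj , col≡j) with P-inv a b v e adj
  ... | inj₂ (refl , Hbe) = ≤-trans h<1+d (m≤m+n (suc d) c) , λ _ j≡1+d → <-irrefl j≡1+d h<1+d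
    where
    h<1+d : j < suc d
    h<1+d = subst (_< suc d) (trans (sym (colour-H a b e)) col≡j) (h≤d b e Hbe)
  ... | inj₁ (av , refl) = subst (_< suc d + c) colG≡j (colourG<1+d+c b a v) ,
      λ cov j≡1+d → false≢true (trans (sym (covered⇒no-M-edge a cov v av)) (colourG≡1+d⇒M b a v av (trans colG≡j j≡1+d)))
    where
    colG≡j : colourG b a v ≡ j
    colG≡j = trans (sym (colour-G a b v b (G-adj⇒≢ a v av))) col≡j

  via-G : ∀ a b v j → Adj G a v → colourG b a v ≡ j → InPalette P colour (a , b) j
  via-G a b v j av e = (v , b) , P-G a b v av , trans (colour-G a b v b (G-adj⇒≢ a v av)) e

  palette-⊇ : ∀ a b j → Palette a j → InPalette P colour (a , b) j
  palette-⊇ a b j (j<1+d+c , uncovered) with j <? suc d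
  ... | yes j≤d with j ≟ℕ μ b
  ...   | no j≢μ with h-inPalette b j j≤d j≢μ
  ...     | e , Hbe , h≡j = (a , e) , P-H a b e Hbe , trans (colour-H a b e) h≡j
  palette-⊇ a b j (j<1+d+c , uncovered) | yes j≤d | yes j≡μ with g-inPalette a 0 0<c
  ...     | v , Gmav , g≡0 = via-G a b v j (Gm⊆G a v Gmav) (trans (colourG-Gm b a v Gmav) (trans (cong (shift (μ b)) g≡0) (sym j≡μ)))
  palette-⊇ a b j (j<1+d+c , uncovered) | no j≰d with m≤n⇒∃[o]m+o≡n (≮⇒≥ j≰d)
  ... | zero , 1+d+0≡j with covered?′ a
  ...   | yes cov = ⊥-elim (uncovered cov (trans (sym 1+d+0≡j) (+-identityʳ (suc d))))
  ...   | no unc with uncovered⇒M-edge a unc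
  ...     | v , Mav , av = via-G a b v j av (trans (colourG-M b a v Mav) (trans (sym (+-identityʳ (suc d))) 1+d+0≡j))
  palette-⊇ a b j (j<1+d+c , uncovered) | no j≰d | suc i , 1+d+1+i≡j
    with g-inPalette a (suc i) (+-cancelˡ-< (suc d) (suc i) c (subst (_< suc d + c) (sym 1+d+1+i≡j) j<1+d+c))
  ... | v , Gmav , g≡1+i = via-G a b v j (Gm⊆G a v Gmav) (trans (colourG-Gm b a v Gmav) (trans (cong (shift (μ b)) g≡1+i) 1+d+1+i≡j))

  samePalette-iff : ∀ a b a′ b′ → (Covered′ a → Covered′ a′) → (Covered′ a′ → Covered′ a) → SamePalette P colour (a , b) (a′ , b′)
  samePalette-iff a b a′ b′ to from j =
    (λ j∈ → palette-⊇ a′ b′ j (transfer from (palette-⊆ a b j j∈))) ,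
    (λ j∈ → palette-⊇ a b j (transfer to (palette-⊆ a′ b′ j j∈)))
    where
    transfer : ∀ {x y} → (Covered′ y → Covered′ x) → Palette x j → Palette y j
    transfer y⇒x (j< , ≢) = j< , λ cov → ≢ (y⇒x cov)

  1+d∈palette⇒uncovered : ∀ a b → InPalette P colour (a , b) (suc d) → ¬ Covered′ a
  1+d∈palette⇒uncovered a b 1+d∈ cov = proj₂ (palette-⊆ a b (suc d) 1+d∈) cov refl

  uncovered⇒1+d∈palette : ∀ a b → ¬ Covered′ a → InPalette P colour (a , b) (suc d)
  uncovered⇒1+d∈palette a b unc = palette-⊇ a b (suc d) (m<m+n (suc d) 0<c , λ cov → ⊥-elim (unc cov))

  class : ∀ {a} → Dec (Covered′ a) → Fin 2
  class (yes _) = Fin.zero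
  class (no _) = Fin.suc Fin.zero

  classify : Fin n × Fin m → Fin 2
  classify (a , b) = class (covered?′ a)

  classify-samePalette : ∀ w z → classify w ≡ classify z → SamePalette P colour w z
  classify-samePalette (a , b) (a′ , b′) = by-cases (covered?′ a) (covered?′ a′)
    where
    by-cases : (ca : Dec (Covered′ a)) (ca′ : Dec (Covered′ a′)) → class ca ≡ class ca′ → SamePalette P colour (a , b) (a′ , b′)
    by-cases (yes cov) (yes cov′) _ = samePalette-iff a b a′ b′ (λ _ → cov′) (λ _ → cov)
    by-cases (no unc) (no unc′) _ = samePalette-iff a b a′ b′ (λ cov → ⊥-elim (unc cov)) (λ cov′ → ⊥-elim (unc′ cov′))

  samePalette-classify : ∀ w z → SamePalette P colour w z → classify w ≡ classify z
  samePalette-classify (a , b) (a′ , b′) same = by-cases (covered?′ a) (covered?′ a′)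
    where
    by-cases : (ca : Dec (Covered′ a)) (ca′ : Dec (Covered′ a′)) → class ca ≡ class ca′
    by-cases (yes _) (yes _) = refl
    by-cases (no _) (no _) = refl
    by-cases (yes cov) (no unc′) =
      ⊥-elim (1+d∈palette⇒uncovered a b (proj₂ (same (suc d)) (uncovered⇒1+d∈palette a′ b′ unc′)) cov)
    by-cases (no unc) (yes cov′) =
      ⊥-elim (1+d∈palette⇒uncovered a′ b′ (proj₁ (same (suc d)) (uncovered⇒1+d∈palette a b unc)) cov′)

  twoPalettes : Fin m → (∃ λ a → Covered′ a) → (∃ λ a → ¬ Covered′ a) → NumPalettes P colour 2
  twoPalettes b₀ (a₀ , cov) (a₁ , unc) =
    classify , surjective , λ w z → classify-samePalette w z , samePalette-classify w z
    where
    surjective : ∀ i → ∃ λ w → classify w ≡ i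
    surjective Fin.zero = (a₀ , b₀) , class-covered (covered?′ a₀)
      where
      class-covered : (ca : Dec (Covered′ a₀)) → class ca ≡ Fin.zero
      class-covered (yes _) = refl
      class-covered (no unc₀) = ⊥-elim (unc₀ cov)
    surjective (Fin.suc Fin.zero) = (a₁ , b₀) , class-uncovered (covered?′ a₁)
      where
      class-uncovered : (ca : Dec (Covered′ a₁)) → class ca ≡ Fin.suc Fin.zero
      class-uncovered (yes cov₁) = ⊥-elim (unc cov₁)
      class-uncovered (no _) = refl

-- One palette is impossible

-- Equal palettes have equal size, which under a proper colouring is the degree.
samePalette⇒count≤ : {V : Set} (_≟ⱽ_ : DecidableEquality V) (P : Graph V) (f : V → V → ℕ) → IsProperEdgeColoring P f →
  ∀ u v (xs ys : List V) → AllPairs (DistinctOn (P u)) xs → (∀ w → Adj P v w → w ∈ ys) →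
  SamePalette P f u v → count (P u) xs ≤ count (P v) ys
samePalette⇒count≤ {V} _≟ⱽ_ P f proper u v xs ys distinct complete same =
  count-≤-injection _≟ⱽ_ (P u) (P v) partner xs ys distinct
    (All.tabulate (λ {w} _ uw → complete (partner w) (proj₁ (partner-spec w uw)) , proj₁ (partner-spec w uw)))
    (λ w w′ uw uw′ e → proj₂ proper u w w′ uw uw′
       (trans (sym (proj₂ (partner-spec w uw))) (trans (cong (f v) e) (proj₂ (partner-spec w′ uw′)))))
  where
  partner′ : ∀ w → Dec (Adj P u w) → V
  partner′ w (yes uw) = proj₁ (proj₁ (same (f u w)) (w , uw , refl))
  partner′ w (no _) = w
  partner : V → V
  partner w = partner′ w (P u w ≟ᴮ true)
  partner-spec : ∀ w → Adj P u w → Adj P v (partner w) × f v (partner w) ≡ f u w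
  partner-spec w uw with P u w ≟ᴮ true
  ... | yes uw′ = proj₂ (proj₁ (same (f u w)) (w , uw′ , refl))
  ... | no ¬uw = ⊥-elim (¬uw uw)

module _ {n m : ℕ} (G : Graph (Fin n)) (H : Graph (Fin m)) (G-irrefl : ∀ a → G a a ≡ false) (H-irrefl : ∀ b → H b b ≡ false) where

  neighbourhood : Fin n × Fin m → List (Fin n × Fin m)
  neighbourhood (a , b) = map (_, b) (allFin n) ++ map (a ,_) (allFin m)

  □-along-G : ∀ a b v → (G □ H) (a , b) (v , b) ≡ G a v
  □-along-G a b v rewrite isYes≗does (b ≟ b) | dec-true (b ≟ b) refl | H-irrefl b with G a v | ⌊ a ≟ v ⌋
  ... | true | _ = refl
  ... | false | true = refl
  ... | false | false = refl

  □-along-H : ∀ a b e → (G □ H) (a , b) (a , e) ≡ H b e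
  □-along-H a b e rewrite G-irrefl a | isYes≗does (a ≟ a) | dec-true (a ≟ a) refl = refl

  count-neighbourhood : ∀ a b → count ((G □ H) (a , b)) (neighbourhood (a , b)) ≡ deg G a + deg H b
  count-neighbourhood a b = begin
    count P-ab (map (_, b) (allFin n) ++ map (a ,_) (allFin m))
      ≡⟨ count-++ P-ab (map (_, b) (allFin n)) (map (a ,_) (allFin m)) ⟩
    count P-ab (map (_, b) (allFin n)) + count P-ab (map (a ,_) (allFin m))
      ≡⟨ cong₂ _+_ (trans (count-map P-ab (_, b) (allFin n)) (count-cong _ (G a) (allFin n) (□-along-G a b)))
                   (trans (count-map P-ab (a ,_) (allFin m)) (count-cong _ (H b) (allFin m) (□-along-H a b))) ⟩
    deg G a + deg H b ∎
    where
    open ≡-Reasoning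
    P-ab : Fin n × Fin m → Bool
    P-ab = (G □ H) (a , b)

  neighbourhood-complete : ∀ a b w → Adj (G □ H) (a , b) w → w ∈ neighbourhood (a , b)
  neighbourhood-complete a b (v , e) adj with G a v | b ≟ e | a ≟ v | H b e
  ... | true | yes refl | _ | _ = ∈-++⁺ˡ (∈-map⁺ (_, b) (∈-allFin v))
  ... | _ | _ | yes refl | true = ∈-++⁺ʳ (map (_, b) (allFin n)) (∈-map⁺ (a ,_) (∈-allFin e))

  neighbourhood-distinct : ∀ a b → AllPairs (DistinctOn ((G □ H) (a , b))) (neighbourhood (a , b))
  neighbourhood-distinct a b = AllPairs.++⁺
    (AllPairs.map⁺ (AllPairs.map (λ v≢v′ _ _ e → v≢v′ (cong proj₁ e)) (allFin⁺ n)))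
    (AllPairs.map⁺ (AllPairs.map (λ e≢e′ _ _ e → e≢e′ (cong proj₂ e)) (allFin⁺ m)))
    (All.tabulate λ {w} w∈ → All.tabulate λ {z} z∈ → across w z w∈ z∈)
    where
    across : ∀ w z → w ∈ map (_, b) (allFin n) → z ∈ map (a ,_) (allFin m) → DistinctOn ((G □ H) (a , b)) w z
    across w z w∈ z∈ adj _ w≡z with ∈-map⁻ (_, b) w∈ | ∈-map⁻ (a ,_) z∈
    ... | v , _ , refl | e , _ , refl with w≡z
    ...   | refl rewrite G-irrefl a | H-irrefl b | isYes≗does (a ≟ a) | dec-true (a ≟ a) refl with adj
    ...     | ()

  samePalette⇒deg≤ : ∀ f → IsProperEdgeColoring (G □ H) f → ∀ a b a′ b′ →
    SamePalette (G □ H) f (a , b) (a′ , b′) → deg G a + deg H b ≤ deg G a′ + deg H b′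
  samePalette⇒deg≤ f proper a b a′ b′ same = begin
    deg G a + deg H b                                         ≡⟨ count-neighbourhood a b ⟨
    count ((G □ H) (a , b)) (neighbourhood (a , b))           ≤⟨ samePalette⇒count≤ (≡-dec _≟_ _≟_) (G □ H) f proper
                                                                   (a , b) (a′ , b′) _ _ (neighbourhood-distinct a b)
                                                                   (neighbourhood-complete a′ b′) same ⟩
    count ((G □ H) (a′ , b′)) (neighbourhood (a′ , b′))       ≡⟨ count-neighbourhood a′ b′ ⟩
    deg G a′ + deg H b′                                       ∎
    where open ≤-Reasoning

  -- A proper colouring with a single palette would make G □ H regular.
  palettes≥2 : ∀ a a′ → deg G a < deg G a′ → Fin m → ∀ f k → IsProperEdgeColoring (G □ H) f → NumPalettes (G □ H) f k → 2 ≤ k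
  palettes≥2 a a′ deg< b f zero proper (label , _) with label (a , b)
  ... | ()
  palettes≥2 a a′ deg< b f (suc zero) proper (label , _ , same-label⇔same) =
    ⊥-elim (<-irrefl refl (≤-trans (+-monoˡ-< (deg H b) deg<)
      (samePalette⇒deg≤ f proper a′ b a b (proj₁ (same-label⇔same (a′ , b) (a , b)) (one-label _ _)))))
    where
    one-label : ∀ (i j : Fin 1) → i ≡ j
    one-label Fin.zero Fin.zero = refl
  palettes≥2 a a′ deg< b f (suc (suc k)) proper _ = s≤s (s≤s z≤n)

theorem2 : (n r : ℕ) (G′ M X : Graph (Fin n)) →
    IsSimple G′ → Connected G′ → 2 ≤ n →
    IsRegularOfDegree G′ r → ChromaticIndex G′ r →
    PerfectMatching G′ M → ClassOne (G′ ∖ M) →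
    NonemptyProperSubset X M →
    (m : ℕ) (H : Graph (Fin m)) → IsSimple H → Connected H → IsRegular H →
    PaletteIndex ((G′ ∖ X) □ H) 2
theorem2 n r G′ M X G′-simple G′-connected _ G′-regular _ M-perfect ((g , g-proper , g<Δ) , _)
         X⊂M@(X⊆M , (a₀ , v₀ , X-a₀v₀) , (a₁ , v₁ , M-a₁v₁ , ¬X-a₁v₁)) m H H-simple (0<m , _) (d , H-regular) =
  (colour , colour-proper , twoPalettes b₀ (a₀ , v₀ , X-a₀v₀) (a₁ , a₁-uncovered)) ,
  palettes≥2 (G′ ∖ X) H G-irrefl (proj₂ H-simple) a₀ a₁
    (deg-covered<deg-uncovered M-perfect X⊆M G′-regular a₀ a₁ (v₀ , X-a₀v₀) a₁-uncovered) b₀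
  where
  Gm-regular : IsRegularOfDegree (G′ ∖ M) (r ∸ 1)
  Gm-regular a = trans (sym (m+n∸n≡m _ 1)) (cong (_∸ 1) (trans (deg-∖-perfectMatching M-perfect a) (G′-regular a)))
  g<r-1 : ∀ u v → Adj (G′ ∖ M) u v → g u v < r ∸ 1
  g<r-1 u v e = ≤-trans (g<Δ u v e) (maxDeg≤ (G′ ∖ M) (r ∸ 1) (λ a → ≤-reflexive (Gm-regular a)))
  open Vizing H (proj₁ H-simple) (proj₂ H-simple) d (λ b → ≤-reflexive (H-regular b)) using (vizing; module ProperColouring)
  open ProperColouring vizing using () renaming (col to h; proper to h-proper; col<k to h<1+d)
  open TwoPaletteColouring G′ M X H G′-simple M-perfect X⊆M (r ∸ 1)
    (∸-monoˡ-≤ 1 (regular-degree≥2 G′-connected G′-regular M-perfect X⊂M)) Gm-regular g g-proper g<r-1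
    H-simple d H-regular h h-proper h<1+d
  b₀ : Fin m
  b₀ = fromℕ< 0<m
  a₁-uncovered : ¬ Covered M-perfect X⊆M a₁
  a₁-uncovered = M∖X-end-uncovered M-perfect X⊆M a₁ v₁ M-a₁v₁ ¬X-a₁v₁
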